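{- Let $q$ be a prime power, $\ell\ge1$, $D\subseteq\mathbb{F}_q$ and $S\subseteq D$. In the ring of formal power series in $z$ over the group algebra $\mathbb{Q}\mathcal{E}$, $$F(z)=\sum_{d=0}^{\ell-1}\sum_{f\in\mathcal{M}_d}\langle f\rangle z^d+\frac{(qz)^\ell}{1-qz}E,\qquad F(z;\supseteq S)=\Big(\prod_{\alpha\in S}\langle x+\alpha\rangle\Big)z^{|S|}F(z),$$ $$F(z;S)=\Big(\prod_{\alpha\in S}\langle x+\alpha\rangle\Big)z^{|S|}F(z)\prod_{\beta\in\mathbb{F}_q\setminus S}\big(\langle1\rangle-\langle x+\beta\rangle z\big).$$
   Context: $\mathcal{M}$ is the set of monic polynomials over $\mathbb{F}_q$ and $\mathcal{M}_d$ those of degree $d$. For $h=x^d+h_1x^{d-1}+\dots+h_d$ set $h_i=0$ for $i>d$; two monic polynomials are equivalent if their tuples $(h_1,\dots,h_\ell)$ agree. $\langle h\rangle$ is the equivalence class of $h$, $\mathcal{E}$ the set of classes; $\mathcal{E}$ is a group of order $q^\ell$ under $\langle g\rangle\langle h\rangle=\langle gh\rangle$, with identity $\langle1\rangle$, and $\mathbb{Q}\mathcal{E}$ is its group algebra over $\mathbb{Q}$. $E=q^{ -\ell}\sum_{\varepsilon\in\mathcal{E}}\varepsilon$. $\mathcal{M}_d(\varepsilon)$ is the set of polynomials in $\mathcal{M}_d$ in class $\varepsilon$. $N_d(\varepsilon,S)$ is the number of $f\in\mathcal{M}_d(\varepsilon)$ of the form $f=g\prod_{\alpha\in S}(x+\alpha)$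 where $g$ has no factor $x+\beta$ with $\beta\in\mathbb{F}_q\setminus S$; $M_d(\varepsilon,S)$ is the number of $f\in\mathcal{M}_d(\varepsilon)$ divisible by $\prod_{\alpha\in S}(x+\alpha)$. $F(z)=\sum_{f\in\mathcal{M}}\langle f\rangle z^{\deg f}$, $F(z;S)=\sum_{d\ge0}z^d\sum_{\varepsilon\in\mathcal{E}}N_d(\varepsilon,S)\varepsilon$, $F(z;\supseteq S)=\sum_{d\ge0}z^d\sum_{\varepsilon\in\mathcal{E}}M_d(\varepsilon,S)\varepsilon$. -}

module Defs where

open import Level using (0ℓ)
open import Data.Nat as ℕ using (ℕ; zero; suc; _∸_; _≤?_; NonZero)
open import Data.Nat.Properties using (m^n≢0)
open import Data.Integer as ℤ using (ℤ)
open import Data.Rational as ℚ using (ℚ; 0ℚ; 1ℚ; _+_; _*_; -_)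
open import Data.List as List using (List; []; _∷_; length; map; foldr; upTo; filter; concatMap; take; replicate; _++_)
open import Data.List.Membership.Propositional using (_∈_; _∉_)
open import Data.List.Relation.Unary.Any using (Any; any?)
open import Data.List.Relation.Unary.All using (All; all?)
open import Data.List.Relation.Unary.Unique.Propositional using (Unique)
open import Data.List.Membership.DecPropositional using () renaming (_∈?_ to ∈?[_])
open import Data.List.Properties using (≡-dec)
open import Data.Vec as Vec using (Vec; toList; fromList)
import Data.Vec.Properties as VecP
import Data.Fin
open import Data.Product using (Σ; _×_; _,_; ∃)
open import Relation.Nullary using (Dec; yes; no; ¬_)
open import Relation.Nullary.Decidable using (_×-dec_; ¬?; ⌊_⌋)
open import Relation.Binary.PropositionalEquality using (_≡_; _≢_; refl)
open import Relation.Binary.Definitions using (DecidableEquality)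
open import Algebra.Structures using (IsCommutativeRing)
open import Data.Bool using (if_then_else_)

record FiniteField : Set₁ where
  field
    K     : Set
    _≟_   : DecidableEquality K
    _+K_  : K → K → K
    _*K_  : K → K → K
    -K_   : K → K
    0K    : K
    1K    : K
    isCommutativeRing : IsCommutativeRing _≡_ _+K_ _*K_ -K_ 0K 1K
    0≢1   : 0K ≢ 1K
    inverse : ∀ x → x ≢ 0K → Σ K (λ y → (x *K y) ≡ 1K)
    elems    : List K
    elems-unique   : Unique elems
    elems-complete : ∀ x → x ∈ elems

  q : ℕ
  q = length elems

private
  nonEmpty : ∀ {A : Set} {x : A} (xs : List A) → x ∈ xs → NonZero (length xs)
  nonEmpty (_ ∷ _) _ = _

module Setup (𝔽 : FiniteField) (ℓ : ℕ) where
  open FiniteField 𝔽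

  instance
    q-nonZero : NonZero q
    q-nonZero = nonEmpty elems (elems-complete 0K)

  qℓ-nonZero : NonZero (q ℕ.^ ℓ)
  qℓ-nonZero = m^n≢0 q ℓ

  -- Monic polynomials.  A monic polynomial x^d + h₁x^{d-1} + … + h_d is
  -- represented by the list [h₁, …, h_d] (its degree is the length).

  Monic : Set
  Monic = List K

  -- coefficient k (k = 0 is the leading 1) of a monic polynomial
  coeff : Monic → ℕ → K
  coeff h zero = 1K
  coeff [] (suc k) = 0K
  coeff (a ∷ h) (suc zero) = a
  coeff (a ∷ h) (suc (suc k)) = coeff h (suc k)

  sumK : List K → K
  sumK = foldr _+K_ 0K

  mulM : Monic → Monic → Monic
  mulM g h = map (λ k → sumK (map (λ i → coeff g i *K coeff h (k ∸ i)) (upTo (suc k))))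
                 (List.drop 1 (upTo (suc (length g ℕ.+ length h))))

  allMonic : ℕ → List Monic
  allMonic zero = [] ∷ []
  allMonic (suc d) = concatMap (λ a → map (a ∷_) (allMonic d)) elems

  lin : K → Monic
  lin α = α ∷ []

  prodM : List Monic → Monic
  prodM = foldr mulM []

  Divides : Monic → Monic → Set
  Divides g f = (length g ℕ.≤ length f) × Any (λ h → mulM h g ≡ f) (allMonic (length f ∸ length g))

  -- Equivalence classes: the tuple (h₁,…,h_ℓ) with h_i = 0 for i > d.

  Cls : Set
  Cls = Vec K ℓ

  cls : Monic → Cls
  cls h = Vec.map (λ i → coeff h (suc (Data.Fin.toℕ i))) (Vec.allFin ℓ)

  _≟C_ : DecidableEquality Cls
  _≟C_ = VecP.≡-dec _≟_

  _·C_ : Cls → Cls → Cls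
  a ·C b = cls (mulM (toList a) (toList b))

  allCls : List Cls
  allCls = List.map fromList′ (allMonic ℓ)
    where
      fromList′ : Monic → Cls
      fromList′ h = cls h

  -- The group algebra ℚℰ: functions ℰ → ℚ (coefficient of each ε).

  QE : Set
  QE = Cls → ℚ

  sumℚ : List ℚ → ℚ
  sumℚ = foldr _+_ 0ℚ

  _⊕_ : QE → QE → QE
  (a ⊕ b) ε = a ε + b ε

  _⊛_ : QE → QE → QE
  (a ⊛ b) ε = sumℚ (List.map (λ e₁ → sumℚ (List.map (λ e₂ →
      if ⌊ (e₁ ·C e₂) ≟C ε ⌋ then a e₁ * b e₂ else 0ℚ) allCls)) allCls)

  zeroQE : QE
  zeroQE _ = 0ℚ

  ⟪_⟫ : Cls → QE
  ⟪ e ⟫ ε = if ⌊ e ≟C ε ⌋ then 1ℚ else 0ℚ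

  ⟨_⟩ : Monic → QE
  ⟨ f ⟩ = ⟪ cls f ⟫

  scaleQE : ℚ → QE → QE
  scaleQE c a ε = c * a ε

  E : QE
  E _ = ℤ.+ 1 ℚ./ (q ℕ.^ ℓ)
    where instance _ = qℓ-nonZero

  sumQE : List QE → QE
  sumQE = foldr _⊕_ zeroQE

  prodQE : List QE → QE
  prodQE = foldr _⊛_ ⟨ [] ⟩

  -- Formal power series in z over ℚℰ: coefficient sequences.

  PS : Set
  PS = ℕ → QE

  _⊕ₛ_ : PS → PS → PS
  (A ⊕ₛ B) n = A n ⊕ B n

  _⊛ₛ_ : PS → PS → PS
  (A ⊛ₛ B) n = sumQE (List.map (λ k → A k ⊛ B (n ∸ k)) (upTo (suc n)))

  mono : QE → ℕ → PS
  mono a k n = if ⌊ n ℕ.≟ k ⌋ then a else zeroQE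

  const : QE → PS
  const a = mono a 0

  prodₛ : List PS → PS
  prodₛ = foldr _⊛ₛ_ (const ⟨ [] ⟩)

  -- 1/(1 - c z) = Σ_n c^n z^n, the inverse of 1 - c z in ℚℰ[[z]]
  geom : ℕ → PS
  geom c n = scaleQE (ℤ.+ (c ℕ.^ n) ℚ./ 1) ⟨ [] ⟩

  _≋_ : PS → PS → Set
  A ≋ B = ∀ n ε → A n ε ≡ B n ε

  count : {P : Monic → Set} → ((f : Monic) → Dec (P f)) → List Monic → ℕ
  count P? xs = length (filter P? xs)

  Divides? : ∀ g f → Dec (Divides g f)
  Divides? g f = (length g ℕ.≤? length f) ×-dec any? (λ h → ≡-dec _≟_ (mulM h g) f) (allMonic (length f ∸ length g))

  _∈?K_ : (x : K) (xs : List K) → Dec (x ∈ xs)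
  x ∈?K xs = ∈?[ _≟_ ] x xs

  complement : List K → List K
  complement S = filter (λ β → ¬? (β ∈?K S)) elems

  IsN : List K → Monic → Set
  IsN S f = Any (λ g → (mulM g (prodM (map lin S)) ≡ f) × All (λ β → ¬ Divides (lin β) g) (complement S))
                         (allMonic (length f ∸ length S))

  IsN? : (S : List K) → (f : Monic) → Dec (IsN S f)
  IsN? S f = any? (λ g → ≡-dec _≟_ (mulM g (prodM (map lin S))) f
                         ×-dec all? (λ β → ¬? (Divides? (lin β) g)) (complement S))
                     (allMonic (length f ∸ length S))

  N : ℕ → Cls → List K → ℕ
  N d ε S = count (λ f → (cls f ≟C ε) ×-dec IsN? S f) (allMonic d)

  M : ℕ → Cls → List K → ℕ
  M d ε S = count (λ f → (cls f ≟C ε) ×-dec Divides? (prodM (map lin S)) f) (allMonic d)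

  toℚ : ℕ → ℚ
  toℚ n = ℤ.+ n ℚ./ 1

  Fz : PS
  Fz d = sumQE (map ⟨_⟩ (allMonic d))

  FzS : List K → PS
  FzS S d ε = toℚ (N d ε S)

  Fz⊇S : List K → PS
  Fz⊇S S d ε = toℚ (M d ε S)

  lowPart : PS
  lowPart = foldr _⊕ₛ_ (λ _ → zeroQE) (map (λ d → mono (sumQE (map ⟨_⟩ (allMonic d))) d) (upTo ℓ))

  tailPart : PS
  tailPart = (mono (scaleQE (toℚ (q ℕ.^ ℓ)) ⟨ [] ⟩) ℓ ⊛ₛ geom q) ⊛ₛ const E

  linPart : List K → PS
  linPart S = mono (prodQE (map (λ α → ⟨ lin α ⟩) S)) (length S)

  oneMinus : K → PS
  oneMinus β = const ⟨ [] ⟩ ⊕ₛ mono (scaleQE (- 1ℚ) ⟨ lin β ⟩) 1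

-- The class ⟨f⟩ only sees the coefficients h₁,…,h_ℓ, and ⟨gh⟩ = ⟨g⟩⟨h⟩.  In degree d ≥ ℓ those ℓ coefficients
-- range freely over F_q^ℓ, so every class contains exactly q^(d-ℓ) polynomials, which is the coefficient of z^d
-- in (qz)^ℓ/(1-qz)·E.  Multiplication by P = ∏_{α∈S}(x+α) is injective, raises the degree by |S| and multiplies
-- classes by ⟨P⟩, so the multiples of P are counted by ⟨P⟩ z^{|S|} F(z), and the polynomials P g with g free of
-- the factors x+β, β ∉ S, by ⟨P⟩ z^{|S|} times the series of such g.  That series is obtained from F(z) one
-- factor at a time: among the polynomials avoiding a set R of linear factors, those divisible by x+β (β ∉ R) are
-- (x+β)·g with g avoiding R, since x+β is prime; so multiplying by ⟨1⟩ - ⟨x+β⟩z leaves those avoiding R ∪ {β}.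
module Submission where

open import Defs
open import Data.Nat using (ℕ; _≤_)
open import Data.List using (List; map)
open import Data.List.Relation.Unary.Unique.Propositional using (Unique)
open import Data.List.Relation.Binary.Subset.Propositional using (_⊆_)
open import Data.Product using (_×_)

open import Data.Nat as ℕ using (zero; suc; _∸_; _<_; z≤n; s≤s; _^_; NonZero)
import Data.Nat.Properties as ℕP
import Data.Nat.Coprimality as Coprimality
import Data.Integer as ℤ
import Data.Integer.Properties as ℤP
open import Data.Rational as ℚ using (ℚ; 0ℚ; 1ℚ; _+_; _*_; -_)
import Data.Rational.Properties as ℚP
open import Data.Bool using (Bool; true; false; if_then_else_)
open import Data.Empty using (⊥; ⊥-elim)
open import Data.Unit using (⊤; tt)
open import Data.Product using (Σ; _,_; proj₁; proj₂)
open import Data.Sum using (inj₁; inj₂)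
open import Data.List as List using ([]; _∷_; foldr; upTo; applyUpTo; length; filter; concatMap; take; _++_)
import Data.List.Properties as LP
open import Data.List.Membership.Propositional using (_∈_; _∉_; find; lose)
open import Data.List.Membership.Propositional.Properties
  using (∈-map⁺; ∈-map⁻; ∈-filter⁻; ∈-filter⁺; ∈-++⁻; ∈-concatMap⁺; ∈-concatMap⁻)
open import Data.List.Membership.Propositional.Properties.WithK using (unique∧set⇒bag)
open import Data.List.Relation.Unary.Any as Any using (Any; here; there)
open import Data.List.Relation.Unary.All as All using (All; []; _∷_)
import Data.List.Relation.Unary.All.Properties as AllP
open import Data.List.Relation.Unary.AllPairs using ([]; _∷_)
import Data.List.Relation.Unary.Unique.Propositional.Properties as Unique
open import Data.List.Relation.Binary.BagAndSetEquality using (∼bag⇒↭)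
open import Data.List.Relation.Binary.Permutation.Propositional using (_↭_; ↭-sym)
open import Data.List.Relation.Binary.Permutation.Propositional.Properties using (↭-length; filter-↭; All-resp-↭; shift)
open import Data.Vec as Vec using (Vec; toList; _∷_)
import Data.Vec.Properties as VecP
import Data.Fin as Fin
open Fin using (Fin)
import Data.Fin.Properties as FinP
open import Function using (id; _∘_; _∘′_; _⇔_; mk⇔; Equivalence)
open import Algebra.Bundles using (CommutativeRing)
open import Algebra.Structures using (IsCommutativeMonoid; IsCommutativeSemiring; IsCommutativeRing)
import Algebra.Properties.Group as GroupProperties
import Algebra.Properties.Ring as RingProperties
import Algebra.Solver.Ring.NaturalCoefficients.Default as NaturalCoefficientSolver
open import Relation.Nullary using (Dec; yes; no; ¬_)
open import Relation.Nullary.Decidable using (⌊_⌋; _×-dec_; ¬?)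
open import Relation.Binary.Definitions using (DecidableEquality)
open import Relation.Binary.Bundles using (Setoid)
import Relation.Binary.Reasoning.Setoid as SetoidReasoning
open import Relation.Binary.PropositionalEquality

module Sum {A : Set} {_∙_ : A → A → A} {ε : A} (isCM : IsCommutativeMonoid _≡_ _∙_ ε) where

  open IsCommutativeMonoid isCM using (assoc; comm; identityˡ; identityʳ)

  interchange : ∀ a b c d → (a ∙ b) ∙ (c ∙ d) ≡ (a ∙ c) ∙ (b ∙ d)
  interchange a b c d = begin
    (a ∙ b) ∙ (c ∙ d) ≡⟨ assoc a b (c ∙ d) ⟩
    a ∙ (b ∙ (c ∙ d)) ≡⟨ cong (a ∙_) (sym (assoc b c d)) ⟩
    a ∙ ((b ∙ c) ∙ d) ≡⟨ cong (λ z → a ∙ (z ∙ d)) (comm b c) ⟩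
    a ∙ ((c ∙ b) ∙ d) ≡⟨ cong (a ∙_) (assoc c b d) ⟩
    a ∙ (c ∙ (b ∙ d)) ≡⟨ sym (assoc a c (b ∙ d)) ⟩
    (a ∙ c) ∙ (b ∙ d) ∎
    where open ≡-Reasoning

  ∑ : {B : Set} → (B → A) → List B → A
  ∑ f xs = foldr _∙_ ε (map f xs)

  syntax ∑ (λ x → e) xs = ∑[ x ← xs ] e

  module _ {B : Set} where

    ∑-cong : ∀ {f g : B → A} xs → (∀ {x} → x ∈ xs → f x ≡ g x) → ∑ f xs ≡ ∑ g xs
    ∑-cong []       f≡g = refl
    ∑-cong (x ∷ xs) f≡g = cong₂ _∙_ (f≡g (here refl)) (∑-cong xs (f≡g ∘ there))

    ∑-congˡ : ∀ {f g : B → A} xs → (∀ x → f x ≡ g x) → ∑ f xs ≡ ∑ g xs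
    ∑-congˡ xs f≡g = ∑-cong xs (λ {x} _ → f≡g x)

    ∑-ε : ∀ (xs : List B) → ∑[ _ ← xs ] ε ≡ ε
    ∑-ε []       = refl
    ∑-ε (x ∷ xs) = trans (identityˡ _) (∑-ε xs)

    ∑-zero : ∀ {f : B → A} xs → (∀ {x} → x ∈ xs → f x ≡ ε) → ∑ f xs ≡ ε
    ∑-zero xs f≡ε = trans (∑-cong xs f≡ε) (∑-ε xs)

    ∑-∙ : ∀ (f g : B → A) xs → ∑[ x ← xs ] (f x ∙ g x) ≡ ∑ f xs ∙ ∑ g xs
    ∑-∙ f g []       = sym (identityˡ ε)
    ∑-∙ f g (x ∷ xs) = trans (cong ((f x ∙ g x) ∙_) (∑-∙ f g xs)) (interchange _ _ _ _)

    ∑-++ : ∀ (f : B → A) xs ys → ∑ f (xs ++ ys) ≡ ∑ f xs ∙ ∑ f ys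
    ∑-++ f []       ys = sym (identityˡ _)
    ∑-++ f (x ∷ xs) ys = trans (cong (f x ∙_) (∑-++ f xs ys)) (sym (assoc (f x) _ _))

  ∑-comm : ∀ {B C : Set} (f : B → C → A) xs ys →
           ∑[ x ← xs ] ∑[ y ← ys ] f x y ≡ ∑[ y ← ys ] ∑[ x ← xs ] f x y
  ∑-comm f []       ys = sym (∑-ε ys)
  ∑-comm f (x ∷ xs) ys = trans (cong (∑ (f x) ys ∙_) (∑-comm f xs ys))
                               (sym (∑-∙ (f x) (λ y → ∑[ x ← xs ] f x y) ys))

  ∑-map : ∀ {B C : Set} (f : C → A) (g : B → C) xs → ∑ f (map g xs) ≡ ∑ (f ∘ g) xs
  ∑-map f g []       = refl
  ∑-map f g (x ∷ xs) = cong (f (g x) ∙_) (∑-map f g xs)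

  ∑-concatMap : ∀ {B C : Set} (f : C → A) (g : B → List C) xs →
                ∑ f (concatMap g xs) ≡ ∑[ x ← xs ] ∑ f (g x)
  ∑-concatMap f g []       = refl
  ∑-concatMap f g (x ∷ xs) = trans (∑-++ f (g x) (concatMap g xs)) (cong (∑ f (g x) ∙_) (∑-concatMap f g xs))

  ∑< : ℕ → (ℕ → A) → A
  ∑< zero    h = ε
  ∑< (suc n) h = h 0 ∙ ∑< n (h ∘ suc)

  ∑-applyUpTo : ∀ (h : ℕ → A) (g : ℕ → ℕ) n → ∑ h (applyUpTo g n) ≡ ∑< n (h ∘ g)
  ∑-applyUpTo h g zero    = refl
  ∑-applyUpTo h g (suc n) = cong (h (g 0) ∙_) (∑-applyUpTo h (g ∘ suc) n)

  ∑-upTo : ∀ (h : ℕ → A) n → ∑ h (upTo n) ≡ ∑< n h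
  ∑-upTo h = ∑-applyUpTo h id

  ∑<-snoc : ∀ n h → ∑< (suc n) h ≡ ∑< n h ∙ h n
  ∑<-snoc zero    h = trans (identityʳ _) (sym (identityˡ _))
  ∑<-snoc (suc n) h = trans (cong (h 0 ∙_) (∑<-snoc n (h ∘ suc))) (sym (assoc _ _ _))

  ∑<-cong : ∀ n {h h′} → (∀ {i} → i < n → h i ≡ h′ i) → ∑< n h ≡ ∑< n h′
  ∑<-cong zero    h≡h′ = refl
  ∑<-cong (suc n) h≡h′ = cong₂ _∙_ (h≡h′ (s≤s z≤n)) (∑<-cong n (h≡h′ ∘ s≤s))

  ∑<-∙ : ∀ n h h′ → ∑< n (λ i → h i ∙ h′ i) ≡ ∑< n h ∙ ∑< n h′
  ∑<-∙ zero    h h′ = sym (identityˡ ε)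
  ∑<-∙ (suc n) h h′ = trans (cong ((h 0 ∙ h′ 0) ∙_) (∑<-∙ n (h ∘ suc) (h′ ∘ suc))) (interchange _ _ _ _)

  ∑<-zero : ∀ n {h} → (∀ {i} → i < n → h i ≡ ε) → ∑< n h ≡ ε
  ∑<-zero zero    h≡ε = refl
  ∑<-zero (suc n) h≡ε = trans (cong₂ _∙_ (h≡ε (s≤s z≤n)) (∑<-zero n (h≡ε ∘ s≤s))) (identityˡ ε)

  ∑<-single : ∀ n j h → j < n → (∀ {i} → i < n → i ≢ j → h i ≡ ε) → ∑< n h ≡ h j
  ∑<-single (suc n) zero h _ h≡ε =
    trans (cong (h 0 ∙_) (∑<-zero n (λ i<n → h≡ε (s≤s i<n) (λ ())))) (identityʳ _)
  ∑<-single (suc n) (suc j) h (s≤s j<n) h≡ε =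
    trans (cong₂ _∙_ (h≡ε (s≤s z≤n) (λ ())) (∑<-single n j (h ∘ suc) j<n (λ i<n i≢j → h≡ε (s≤s i<n) (i≢j ∘ ℕP.suc-injective))))
          (identityˡ _)

  ∑<-reverse : ∀ n h → ∑< n h ≡ ∑< n (λ i → h (n ∸ suc i))
  ∑<-reverse zero    h = refl
  ∑<-reverse (suc n) h = begin
    h 0 ∙ ∑< n (h ∘ suc)                     ≡⟨ cong (h 0 ∙_) (∑<-reverse n (h ∘ suc)) ⟩
    h 0 ∙ ∑< n (λ i → h (suc (n ∸ suc i)))   ≡⟨ comm _ _ ⟩
    ∑< n (λ i → h (suc (n ∸ suc i))) ∙ h 0   ≡⟨ cong₂ _∙_ (∑<-cong n (λ i<n → cong h (sym (ℕP.+-∸-assoc 1 i<n))))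
                                                          (cong h (sym (ℕP.n∸n≡0 n))) ⟩
    ∑< n (λ i → h (n ∸ i)) ∙ h (n ∸ n)       ≡⟨ ∑<-snoc n (λ i → h (n ∸ i)) ⟨
    ∑< (suc n) (λ i → h (suc n ∸ suc i))     ∎
    where open ≡-Reasoning

  ∑<-triangle : ∀ k (F : ℕ → ℕ → A) →
    ∑< (suc k) (λ m → ∑< (suc m) (λ i → F i m)) ≡ ∑< (suc k) (λ i → ∑< (suc (k ∸ i)) (λ j → F i (i ℕ.+ j)))
  ∑<-triangle zero    F = refl
  ∑<-triangle (suc k) F = begin
    ∑< (suc (suc k)) Row
      ≡⟨ ∑<-snoc (suc k) Row ⟩
    ∑< (suc k) Row ∙ Row (suc k)
      ≡⟨ cong₂ _∙_ (∑<-triangle k F) (∑<-snoc (suc k) (λ i → F i (suc k))) ⟩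
    ∑< (suc k) Col ∙ (∑< (suc k) (λ i → F i (suc k)) ∙ F (suc k) (suc k))
      ≡⟨ assoc _ _ _ ⟨
    (∑< (suc k) Col ∙ ∑< (suc k) (λ i → F i (suc k))) ∙ F (suc k) (suc k)
      ≡⟨ cong₂ _∙_ (∑<-∙ (suc k) Col (λ i → F i (suc k))) (trans (identityʳ _) (cong (F (suc k)) (ℕP.+-identityʳ (suc k)))) ⟨
    ∑< (suc k) (λ i → Col i ∙ F i (suc k)) ∙ (F (suc k) (suc k ℕ.+ 0) ∙ ε)
      ≡⟨ cong (_∙ (F (suc k) (suc k ℕ.+ 0) ∙ ε)) (∑<-cong (suc k) (sym ∘ Col′-snoc)) ⟩
    ∑< (suc k) Col′ ∙ ∑< 1 (λ j → F (suc k) (suc k ℕ.+ j))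
      ≡⟨ cong (λ z → ∑< (suc k) Col′ ∙ ∑< (suc z) (λ j → F (suc k) (suc k ℕ.+ j))) (ℕP.n∸n≡0 (suc k)) ⟨
    ∑< (suc k) Col′ ∙ Col′ (suc k)
      ≡⟨ ∑<-snoc (suc k) Col′ ⟨
    ∑< (suc (suc k)) Col′ ∎
    where
      open ≡-Reasoning
      Row Col Col′ : ℕ → A
      Row  m = ∑< (suc m) (λ i → F i m)
      Col  i = ∑< (suc (k ∸ i)) (λ j → F i (i ℕ.+ j))
      Col′ i = ∑< (suc (suc k ∸ i)) (λ j → F i (i ℕ.+ j))
      Col′-snoc : ∀ {i} → i < suc k → Col′ i ≡ Col i ∙ F i (suc k)
      Col′-snoc {i} (s≤s i≤k) = begin
        Col′ i                                       ≡⟨ cong (λ z → ∑< (suc z) (λ j → F i (i ℕ.+ j))) (ℕP.+-∸-assoc 1 i≤k) ⟩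
        ∑< (suc (suc (k ∸ i))) (λ j → F i (i ℕ.+ j)) ≡⟨ ∑<-snoc (suc (k ∸ i)) (λ j → F i (i ℕ.+ j)) ⟩
        Col i ∙ F i (i ℕ.+ suc (k ∸ i))              ≡⟨ cong (λ z → Col i ∙ F i z) (trans (ℕP.+-suc i (k ∸ i)) (cong suc (ℕP.m+[n∸m]≡n i≤k))) ⟩
        Col i ∙ F i (suc k)                          ∎

module SemiringSum {A : Set} {_+_ _*_ : A → A → A} {0# 1# : A}
                   (isCS : IsCommutativeSemiring _≡_ _+_ _*_ 0# 1#) where

  open IsCommutativeSemiring isCS using (+-isCommutativeMonoid; +-identityˡ; *-comm; *-assoc; zeroˡ; zeroʳ; distribˡ)
  open Sum +-isCommutativeMonoid public

  ∑-distribˡ : ∀ {B : Set} c (f : B → A) xs → c * ∑ f xs ≡ ∑[ x ← xs ] (c * f x)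
  ∑-distribˡ c f []       = zeroʳ c
  ∑-distribˡ c f (x ∷ xs) = trans (distribˡ c (f x) _) (cong ((c * f x) +_) (∑-distribˡ c f xs))

  ∑-distribʳ : ∀ {B : Set} c (f : B → A) xs → ∑ f xs * c ≡ ∑[ x ← xs ] (f x * c)
  ∑-distribʳ c f xs = trans (*-comm _ c) (trans (∑-distribˡ c f xs) (∑-congˡ xs (λ x → *-comm c (f x))))

  ∑<-distribˡ : ∀ n c h → c * ∑< n h ≡ ∑< n (λ i → c * h i)
  ∑<-distribˡ zero    c h = zeroʳ c
  ∑<-distribˡ (suc n) c h = trans (distribˡ c (h 0) _) (cong ((c * h 0) +_) (∑<-distribˡ n c (h ∘ suc)))

  ∑<-distribʳ : ∀ n c h → ∑< n h * c ≡ ∑< n (λ i → h i * c)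
  ∑<-distribʳ n c h = trans (*-comm _ c) (trans (∑<-distribˡ n c h) (∑<-cong n (λ {i} _ → *-comm c (h i))))

  when : Bool → A → A
  when b x = if b then x else 0#

  when-+ : ∀ b x y → when b (x + y) ≡ when b x + when b y
  when-+ true  x y = refl
  when-+ false x y = sym (+-identityˡ 0#)

  when-0 : ∀ b → when b 0# ≡ 0#
  when-0 true  = refl
  when-0 false = refl

  when-*ˡ : ∀ b c x → when b (c * x) ≡ c * when b x
  when-*ˡ true  c x = refl
  when-*ˡ false c x = sym (zeroʳ c)

  when-*ʳ : ∀ b x c → when b (x * c) ≡ when b x * c
  when-*ʳ true  x c = refl
  when-*ʳ false x c = sym (zeroˡ c)

  when-comm : ∀ b b′ x → when b (when b′ x) ≡ when b′ (when b x)
  when-comm true  b′    x = refl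
  when-comm false true  x = refl
  when-comm false false x = refl

  when-∑ : ∀ {B : Set} b (f : B → A) xs → when b (∑ f xs) ≡ ∑[ x ← xs ] when b (f x)
  when-∑ true  f xs = refl
  when-∑ false f xs = sym (∑-ε xs)

  convolution : (ℕ → A) → (ℕ → A) → ℕ → A
  convolution a b k = ∑< (suc k) (λ i → a i * b (k ∸ i))

  convolution-cong : ∀ {a a′ b b′ : ℕ → A} k → (∀ {i} → i ℕ.≤ k → a i ≡ a′ i) → (∀ {i} → i ℕ.≤ k → b i ≡ b′ i) →
                     convolution a b k ≡ convolution a′ b′ k
  convolution-cong k a≡ b≡ = ∑<-cong (suc k) (λ { {i} (s≤s i≤k) → cong₂ _*_ (a≡ i≤k) (b≡ (ℕP.m∸n≤m k i)) })

  convolution-comm : ∀ a b k → convolution a b k ≡ convolution b a k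
  convolution-comm a b k =
    trans (∑<-reverse (suc k) (λ i → a i * b (k ∸ i)))
          (∑<-cong (suc k) (λ { {i} (s≤s i≤k) → trans (cong (λ z → a (k ∸ i) * b z) (ℕP.m∸[m∸n]≡n i≤k)) (*-comm _ _) }))

  convolution-assoc : ∀ a b c k → convolution (convolution a b) c k ≡ convolution a (convolution b c) k
  convolution-assoc a b c k = begin
    ∑< (suc k) (λ m → convolution a b m * c (k ∸ m))
      ≡⟨ ∑<-cong (suc k) (λ {m} _ → ∑<-distribʳ (suc m) (c (k ∸ m)) (λ i → a i * b (m ∸ i))) ⟩
    ∑< (suc k) (λ m → ∑< (suc m) (λ i → F i m))
      ≡⟨ ∑<-triangle k F ⟩
    ∑< (suc k) (λ i → ∑< (suc (k ∸ i)) (λ j → F i (i ℕ.+ j)))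
      ≡⟨ ∑<-cong (suc k) (λ {i} _ → trans (∑<-cong (suc (k ∸ i)) (λ {j} _ → reindex i j))
                                          (sym (∑<-distribˡ (suc (k ∸ i)) (a i) (λ j → b j * c ((k ∸ i) ∸ j))))) ⟩
    ∑< (suc k) (λ i → a i * convolution b c (k ∸ i)) ∎
    where
      open ≡-Reasoning
      F : ℕ → ℕ → A
      F i m = (a i * b (m ∸ i)) * c (k ∸ m)
      reindex : ∀ i j → F i (i ℕ.+ j) ≡ a i * (b j * c ((k ∸ i) ∸ j))
      reindex i j = trans (cong₂ (λ u v → (a i * b u) * c v) (ℕP.m+n∸m≡n i j) (sym (ℕP.∸-+-assoc k i j)))
                          (*-assoc (a i) _ _)

module _ {A : Set} {_∙_ : A → A → A} {ε : A} (isCM : IsCommutativeMonoid _≡_ _∙_ ε) where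
  open Sum isCM
  open IsCommutativeMonoid isCM using (identityˡ; identityʳ)

  ∑-δ : ∀ {B : Set} (_≟_ : DecidableEquality B) (f : B → A) {x} {ys} → Unique ys → x ∈ ys →
        ∑[ y ← ys ] (if ⌊ x ≟ y ⌋ then f y else ε) ≡ f x
  ∑-δ _≟_ f {x} (x≢ys ∷ _) (here refl) with x ≟ x
  ... | no x≢x = ⊥-elim (x≢x refl)
  ... | yes _  = trans (cong (f x ∙_) (∑-zero _ vanish)) (identityʳ _)
    where
      vanish : ∀ {z} → z ∈ _ → (if ⌊ x ≟ z ⌋ then f z else ε) ≡ ε
      vanish {z} z∈ with x ≟ z
      ... | yes refl = ⊥-elim (All.lookup x≢ys z∈ refl)
      ... | no _     = refl
  ∑-δ _≟_ f {x} {y ∷ _} (y≢ys ∷ u) (there x∈) with x ≟ y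
  ... | yes refl = ⊥-elim (All.lookup y≢ys x∈ refl)
  ... | no _     = trans (identityˡ _) (∑-δ _≟_ f u x∈)

  ∑-δ′ : ∀ {B : Set} (_≟_ : DecidableEquality B) (f : B → A) {x} {ys} → Unique ys → x ∈ ys →
         ∑[ y ← ys ] (if ⌊ y ≟ x ⌋ then f y else ε) ≡ f x
  ∑-δ′ _≟_ f {x} {ys} u x∈ = trans (∑-congˡ ys flip) (∑-δ _≟_ f u x∈)
    where
      flip : ∀ y → (if ⌊ y ≟ x ⌋ then f y else ε) ≡ (if ⌊ x ≟ y ⌋ then f y else ε)
      flip y with y ≟ x | x ≟ y
      ... | yes _   | yes _   = refl
      ... | no _    | no _    = refl
      ... | yes y≡x | no x≢y = ⊥-elim (x≢y (sym y≡x))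
      ... | no y≢x  | yes x≡y = ⊥-elim (y≢x (sym x≡y))

module _ {A : Set} {P : A → Set} (P? : ∀ x → Dec (P x)) where
  open Sum ℕP.+-0-isCommutativeMonoid

  indicator : A → ℕ
  indicator x = if ⌊ P? x ⌋ then 1 else 0

  length-filter≡∑ : ∀ xs → length (filter P? xs) ≡ ∑ indicator xs
  length-filter≡∑ []       = refl
  length-filter≡∑ (x ∷ xs) with P? x
  ... | yes _ = cong suc (length-filter≡∑ xs)
  ... | no _  = length-filter≡∑ xs

  length-filter-× : ∀ {Q : A → Set} (Q? : ∀ x → Dec (Q x)) xs →
    length (filter (λ x → P? x ×-dec Q? x) xs) ≡ length (filter P? (filter Q? xs))
  length-filter-× Q? [] = refl
  length-filter-× Q? (x ∷ xs) with Q? x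
  ... | no _ with P? x
  ...   | yes _ = length-filter-× Q? xs
  ...   | no _  = length-filter-× Q? xs
  length-filter-× Q? (x ∷ xs) | yes _ with P? x
  ...   | yes _ = cong suc (length-filter-× Q? xs)
  ...   | no _  = length-filter-× Q? xs

  length-filter-split : ∀ {Q : A → Set} (Q? : ∀ x → Dec (Q x)) xs →
    length (filter P? xs) ≡ length (filter P? (filter Q? xs)) ℕ.+ length (filter P? (filter (¬? ∘ Q?) xs))
  length-filter-split Q? [] = refl
  length-filter-split Q? (x ∷ xs) with Q? x
  ... | yes _ with P? x
  ...   | yes _ = cong suc (length-filter-split Q? xs)
  ...   | no _  = length-filter-split Q? xs
  length-filter-split Q? (x ∷ xs) | no _ with P? x
  ...   | yes _ = trans (cong suc (length-filter-split Q? xs)) (sym (ℕP.+-suc _ _))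
  ...   | no _  = length-filter-split Q? xs

  -- Duplicate-free lists with the same members are permutations of each other.
  length-filter-sameMembers : ∀ {xs ys} → Unique xs → Unique ys → (∀ {z} → z ∈ xs ⇔ z ∈ ys) →
    length (filter P? xs) ≡ length (filter P? ys)
  length-filter-sameMembers ux uy xs≈ys = ↭-length (filter-↭ P? (∼bag⇒↭ (unique∧set⇒bag ux uy xs≈ys)))

filter-cong-∈ : ∀ {A : Set} {P Q : A → Set} (P? : ∀ x → Dec (P x)) (Q? : ∀ x → Dec (Q x)) xs →
  (∀ {x} → x ∈ xs → P x → Q x) → (∀ {x} → x ∈ xs → Q x → P x) → filter P? xs ≡ filter Q? xs
filter-cong-∈ P? Q? []       _ _ = refl
filter-cong-∈ P? Q? (x ∷ xs) P⇒Q Q⇒P with P? x | Q? x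
... | yes _  | yes _  = cong (x ∷_) (filter-cong-∈ P? Q? xs (P⇒Q ∘ there) (Q⇒P ∘ there))
... | no _   | no _   = filter-cong-∈ P? Q? xs (P⇒Q ∘ there) (Q⇒P ∘ there)
... | yes p  | no ¬q  = ⊥-elim (¬q (P⇒Q (here refl) p))
... | no ¬p  | yes q  = ⊥-elim (¬p (Q⇒P (here refl) q))

Unique-map⁺-∈ : ∀ {A B : Set} (f : A → B) {xs} → (∀ {x y} → x ∈ xs → y ∈ xs → f x ≡ f y → x ≡ y) →
  Unique xs → Unique (map f xs)
Unique-map⁺-∈ f {[]}     inj []          = []
Unique-map⁺-∈ f {x ∷ xs} inj (x∉xs ∷ u) =
  AllP.map⁺ (All.tabulate (λ y∈ fx≡fy → All.lookup x∉xs y∈ (inj (here refl) (there y∈) fx≡fy)))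
  ∷ Unique-map⁺-∈ f (λ x∈ y∈ → inj (there x∈) (there y∈)) u

module MonicPolynomials (𝔽 : FiniteField) (ℓ : ℕ) where
  open FiniteField 𝔽
  open Setup 𝔽 ℓ
  open IsCommutativeRing isCommutativeRing
    using (isCommutativeSemiring; +-identityʳ; *-identityˡ; *-identityʳ; zeroˡ; zeroʳ)
  open SemiringSum isCommutativeSemiring public

  K-commutativeRing : CommutativeRing _ _
  K-commutativeRing = record { isCommutativeRing = isCommutativeRing }

  open GroupProperties (CommutativeRing.+-group K-commutativeRing) using (∙-cancelˡ)

  coeff-[] : ∀ {j} → 0 < j → coeff [] j ≡ 0K
  coeff-[] {suc j} _ = refl

  coeff-beyond : ∀ g {k} → length g < k → coeff g k ≡ 0K
  coeff-beyond []      {suc k}       _       = refl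
  coeff-beyond (a ∷ g) {suc (suc k)} (s≤s p) = coeff-beyond g p

  ≡-by-coeff : ∀ g h → length g ≡ length h → (∀ k → coeff g k ≡ coeff h k) → g ≡ h
  ≡-by-coeff []      []      _     _       = refl
  ≡-by-coeff (a ∷ g) (b ∷ h) |g|≡ g≈h = cong₂ _∷_ (g≈h 1) (≡-by-coeff g h (ℕP.suc-injective |g|≡) g≈h′)
    where
      g≈h′ : ∀ k → coeff g k ≡ coeff h k
      g≈h′ zero    = refl
      g≈h′ (suc k) = g≈h (suc (suc k))

  coeff-applyUpTo : ∀ (F : ℕ → K) (f : ℕ → ℕ) n {j} → j < n → coeff (map F (applyUpTo f n)) (suc j) ≡ F (f j)
  coeff-applyUpTo F f (suc n) {zero}  _       = refl
  coeff-applyUpTo F f (suc n) {suc j} (s≤s p) = coeff-applyUpTo F (f ∘ suc) n p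

  length-mulM : ∀ g h → length (mulM g h) ≡ length g ℕ.+ length h
  length-mulM g h = trans (LP.length-map _ (applyUpTo suc (length g ℕ.+ length h))) (LP.length-applyUpTo suc _)

  convolution-beyond : ∀ g h {k} → length g ℕ.+ length h < k → convolution (coeff g) (coeff h) k ≡ 0K
  convolution-beyond g h {k} p = ∑<-zero (suc k) (λ {i} _ → term i)
    where
      term : ∀ i → coeff g i *K coeff h (k ∸ i) ≡ 0K
      term i with length g ℕP.<? i
      ... | yes |g|<i = trans (cong (_*K coeff h (k ∸ i)) (coeff-beyond g |g|<i)) (zeroˡ _)
      ... | no  |g|≮i = trans (cong (coeff g i *K_) (coeff-beyond h |h|<k∸i)) (zeroʳ _)
        where
          |h|<k∸i : length h < k ∸ i
          |h|<k∸i = subst (_< k ∸ i) (ℕP.m+n∸m≡n i (length h))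
                          (ℕP.∸-monoˡ-< (ℕP.≤-<-trans (ℕP.+-monoˡ-≤ (length h) (ℕP.≮⇒≥ |g|≮i)) p) (ℕP.m≤m+n i _))

  coeff-mulM : ∀ g h k → coeff (mulM g h) k ≡ convolution (coeff g) (coeff h) k
  coeff-mulM g h zero = sym (trans (+-identityʳ _) (*-identityˡ 1K))
  coeff-mulM g h (suc j) with j ℕP.<? (length g ℕ.+ length h)
  ... | yes j<n = trans (coeff-applyUpTo _ suc (length g ℕ.+ length h) j<n) (∑-upTo _ (suc (suc j)))
  ... | no  j≮n = trans (coeff-beyond (mulM g h) (s≤s (ℕP.≤-trans (ℕP.≤-reflexive (length-mulM g h)) (ℕP.≮⇒≥ j≮n))))
                        (sym (convolution-beyond g h (s≤s (ℕP.≮⇒≥ j≮n))))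

  mulM-comm : ∀ g h → mulM g h ≡ mulM h g
  mulM-comm g h = ≡-by-coeff _ _
    (trans (length-mulM g h) (trans (ℕP.+-comm (length g) (length h)) (sym (length-mulM h g))))
    (λ k → trans (coeff-mulM g h k) (trans (convolution-comm (coeff g) (coeff h) k) (sym (coeff-mulM h g k))))

  mulM-assoc : ∀ f g h → mulM (mulM f g) h ≡ mulM f (mulM g h)
  mulM-assoc f g h = ≡-by-coeff _ _ lengths (λ k → begin
    coeff (mulM (mulM f g) h) k                            ≡⟨ coeff-mulM (mulM f g) h k ⟩
    convolution (coeff (mulM f g)) (coeff h) k             ≡⟨ convolution-cong {b = coeff h} k (λ {i} _ → coeff-mulM f g i) (λ _ → refl) ⟩
    convolution (convolution (coeff f) (coeff g)) (coeff h) k ≡⟨ convolution-assoc (coeff f) (coeff g) (coeff h) k ⟩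
    convolution (coeff f) (convolution (coeff g) (coeff h)) k ≡⟨ convolution-cong {a = coeff f} k (λ _ → refl) (λ {i} _ → sym (coeff-mulM g h i)) ⟩
    convolution (coeff f) (coeff (mulM g h)) k             ≡⟨ sym (coeff-mulM f (mulM g h) k) ⟩
    coeff (mulM f (mulM g h)) k                            ∎)
    where
      open ≡-Reasoning
      lengths : length (mulM (mulM f g) h) ≡ length (mulM f (mulM g h))
      lengths = begin
        length (mulM (mulM f g) h)                ≡⟨ length-mulM (mulM f g) h ⟩
        length (mulM f g) ℕ.+ length h            ≡⟨ cong (ℕ._+ length h) (length-mulM f g) ⟩
        length f ℕ.+ length g ℕ.+ length h        ≡⟨ ℕP.+-assoc (length f) (length g) (length h) ⟩
        length f ℕ.+ (length g ℕ.+ length h)      ≡⟨ cong (length f ℕ.+_) (length-mulM g h) ⟨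
        length f ℕ.+ length (mulM g h)            ≡⟨ length-mulM f (mulM g h) ⟨
        length (mulM f (mulM g h))                ∎

  mulM-identityʳ : ∀ g → mulM g [] ≡ g
  mulM-identityʳ g = ≡-by-coeff _ _ (trans (length-mulM g []) (ℕP.+-identityʳ (length g))) (λ k → begin
    coeff (mulM g []) k                    ≡⟨ coeff-mulM g [] k ⟩
    convolution (coeff g) (coeff []) k     ≡⟨ ∑<-single (suc k) k (λ i → coeff g i *K coeff [] (k ∸ i)) ℕP.≤-refl (λ {i} i<1+k i≢k →
                                                trans (cong (coeff g i *K_) (coeff-[] (ℕP.m<n⇒0<n∸m (ℕP.≤∧≢⇒< (ℕP.≤-pred i<1+k) i≢k))))
                                                      (zeroʳ _)) ⟩
    coeff g k *K coeff [] (k ∸ k)          ≡⟨ cong (λ z → coeff g k *K coeff [] z) (ℕP.n∸n≡0 k) ⟩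
    coeff g k *K 1K                        ≡⟨ *-identityʳ _ ⟩
    coeff g k                              ∎)
    where open ≡-Reasoning

  -- Induction from the leading coefficient: in coefficient k of g P every other term is already known to agree.
  mulM-cancelʳ : ∀ P g h → length g ≡ length h → mulM g P ≡ mulM h P → g ≡ h
  mulM-cancelʳ P g h |g|≡|h| gP≡hP = ≡-by-coeff g h |g|≡|h| (λ k → agree (suc k) ℕP.≤-refl)
    where
      lead : ∀ f n → coeff f n *K coeff P (n ∸ n) ≡ coeff f n
      lead f n = trans (cong (λ z → coeff f n *K coeff P z) (ℕP.n∸n≡0 n)) (*-identityʳ _)
      agree : ∀ n {i} → i < n → coeff g i ≡ coeff h i
      agree (suc n) (s≤s i≤n) with ℕP.m≤n⇒m<n∨m≡n i≤n
      ... | inj₁ i<n  = agree n i<n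
      ... | inj₂ refl = ∙-cancelˡ lower _ _ (begin
        lower +K coeff g n
          ≡⟨ cong₂ _+K_ (∑<-cong n (λ {j} j<n → cong (_*K coeff P (n ∸ j)) (agree n j<n))) (lead g n) ⟨
        ∑< n (λ j → coeff g j *K coeff P (n ∸ j)) +K (coeff g n *K coeff P (n ∸ n))
          ≡⟨ ∑<-snoc n (λ j → coeff g j *K coeff P (n ∸ j)) ⟨
        convolution (coeff g) (coeff P) n
          ≡⟨ trans (sym (coeff-mulM g P n)) (trans (cong (λ f → coeff f n) gP≡hP) (coeff-mulM h P n)) ⟩
        convolution (coeff h) (coeff P) n
          ≡⟨ ∑<-snoc n (λ j → coeff h j *K coeff P (n ∸ j)) ⟩
        lower +K (coeff h n *K coeff P (n ∸ n))
          ≡⟨ cong (lower +K_) (lead h n) ⟩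
        lower +K coeff h n ∎)
        where
          open ≡-Reasoning
          lower = ∑< n (λ j → coeff h j *K coeff P (n ∸ j))

  mulM-injectiveʳ : ∀ P {g h} → mulM g P ≡ mulM h P → g ≡ h
  mulM-injectiveʳ P {g} {h} gP≡hP = mulM-cancelʳ P g h
    (ℕP.+-cancelʳ-≡ (length P) (length g) (length h)
      (trans (sym (length-mulM g P)) (trans (cong length gP≡hP) (length-mulM h P))))
    gP≡hP

module LinearFactors (𝔽 : FiniteField) (ℓ : ℕ) where
  open FiniteField 𝔽
  open Setup 𝔽 ℓ
  open MonicPolynomials 𝔽 ℓ
  open IsCommutativeRing isCommutativeRing
    using (+-identityˡ; +-identityʳ; *-identityˡ; zeroˡ; zeroʳ; +-comm; *-comm; *-assoc; -‿inverseˡ)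
  open GroupProperties (CommutativeRing.+-group K-commutativeRing) using (x∙y⁻¹≈ε⇒x≈y)
  open NaturalCoefficientSolver (CommutativeRing.commutativeSemiring K-commutativeRing)

  -- The coefficients after the leading one of (x + β)(p xⁿ + c₁ xⁿ⁻¹ + ⋯ + cₙ).
  timesLinTail : K → K → List K → List K
  timesLinTail p β []       = (β *K p) ∷ []
  timesLinTail p β (c ∷ cs) = (c +K (β *K p)) ∷ timesLinTail c β cs

  timesLin : K → Monic → Monic
  timesLin β h = timesLinTail 1K β h

  horner : K → K → List K → K
  horner t a []       = a
  horner t a (c ∷ cs) = horner t ((a *K t) +K c) cs

  eval : K → Monic → K
  eval t = horner t 1K

  horner-timesLinTail : ∀ t β cs a b p → a ≡ (b *K t) +K p →
    horner t (a +K (β *K b)) (timesLinTail p β cs) ≡ (t +K β) *K horner t a cs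
  horner-timesLinTail t β []       a b p refl =
    solve 4 (λ b p β t → (((((b :* t) :+ p) :+ (β :* b)) :* t) :+ (β :* p)) := (t :+ β) :* ((b :* t) :+ p)) refl b p β t
  horner-timesLinTail t β (c ∷ cs) a b p refl =
    trans (cong (λ z → horner t z (timesLinTail c β cs))
                (solve 5 (λ b p β t c → (((((b :* t) :+ p) :+ (β :* b)) :* t) :+ (c :+ (β :* p)))
                                      := ((((b :* t) :+ p) :* t) :+ c) :+ (β :* ((b :* t) :+ p))) refl b p β t c))
          (horner-timesLinTail t β cs _ _ c refl)

  eval-timesLin : ∀ t β h → eval t (timesLin β h) ≡ (t +K β) *K eval t h
  eval-timesLin t β h =
    trans (cong (λ z → horner t z (timesLin β h)) (sym (trans (cong (1K +K_) (zeroʳ β)) (+-identityʳ 1K))))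
          (horner-timesLinTail t β h 1K 0K 1K (sym (trans (cong (_+K 1K) (zeroˡ t)) (+-identityˡ 1K))))

  -- Synthetic division by x - t of the polynomial with coefficients a, c, cs: the quotient's coefficients after a.
  syntheticDivision : K → K → List K → List K
  syntheticDivision t a []            = []
  syntheticDivision t a (c ∷ [])      = []
  syntheticDivision t a (c ∷ c′ ∷ cs) = ((a *K t) +K c) ∷ syntheticDivision t ((a *K t) +K c) (c′ ∷ cs)

  timesLinTail-syntheticDivision : ∀ t β → t +K β ≡ 0K → ∀ a c cs → horner t a (c ∷ cs) ≡ 0K →
    timesLinTail a β (syntheticDivision t a (c ∷ cs)) ≡ c ∷ cs
  timesLinTail-syntheticDivision t β t+β≡0 a c []        root = cong (_∷ []) (begin
    β *K a                          ≡⟨ sym (trans (cong ((β *K a) +K_) root) (+-identityʳ _)) ⟩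
    (β *K a) +K ((a *K t) +K c)     ≡⟨ solve 4 (λ β a t c → ((β :* a) :+ ((a :* t) :+ c)) := ((a :* (t :+ β)) :+ c)) refl β a t c ⟩
    (a *K (t +K β)) +K c            ≡⟨ cong (λ z → (a *K z) +K c) t+β≡0 ⟩
    (a *K 0K) +K c                  ≡⟨ trans (cong (_+K c) (zeroʳ a)) (+-identityˡ c) ⟩
    c                               ∎)
    where open ≡-Reasoning
  timesLinTail-syntheticDivision t β t+β≡0 a c (c′ ∷ cs) root =
    cong₂ _∷_ head (timesLinTail-syntheticDivision t β t+β≡0 ((a *K t) +K c) c′ cs root)
    where
      head : ((a *K t) +K c) +K (β *K a) ≡ c
      head = trans (solve 4 (λ β a t c → (((a :* t) :+ c) :+ (β :* a)) := ((a :* (t :+ β)) :+ c)) refl β a t c)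
                   (trans (cong (λ z → (a *K z) +K c) t+β≡0) (trans (cong (_+K c) (zeroʳ a)) (+-identityˡ c)))

  x*y≡0⇒y≡0 : ∀ {x y} → x ≢ 0K → x *K y ≡ 0K → y ≡ 0K
  x*y≡0⇒y≡0 {x} {y} x≢0 xy≡0 with inverse x x≢0
  ... | x⁻¹ , xx⁻¹≡1 = begin
    y                    ≡⟨ sym (*-identityˡ y) ⟩
    1K *K y              ≡⟨ cong (_*K y) (trans (sym xx⁻¹≡1) (*-comm x x⁻¹)) ⟩
    (x⁻¹ *K x) *K y      ≡⟨ *-assoc x⁻¹ x y ⟩
    x⁻¹ *K (x *K y)      ≡⟨ cong (x⁻¹ *K_) xy≡0 ⟩
    x⁻¹ *K 0K            ≡⟨ zeroʳ x⁻¹ ⟩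
    0K                   ∎
    where open ≡-Reasoning

  -y+x≢0 : ∀ {x y} → x ≢ y → (-K y) +K x ≢ 0K
  -y+x≢0 {x} {y} x≢y -y+x≡0 = x≢y (x∙y⁻¹≈ε⇒x≈y x y (trans (+-comm x (-K y)) -y+x≡0))

  -- -β′ is a root of the left side but not of x + β, hence a root of g.
  timesLin-coprime : ∀ {β β′ h g} → β ≢ β′ → timesLin β′ h ≡ timesLin β g → Σ Monic (λ h′ → timesLin β′ h′ ≡ g)
  timesLin-coprime {β} {β′} {h} {g} β≢β′ h[x+β′]≡g[x+β] = divide g g[-β′]≡0
    where
      t = -K β′
      g[-β′]≡0 : eval t g ≡ 0K
      g[-β′]≡0 = x*y≡0⇒y≡0 (-y+x≢0 β≢β′) (begin
        (t +K β) *K eval t g     ≡⟨ eval-timesLin t β g ⟨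
        eval t (timesLin β g)    ≡⟨ cong (eval t) h[x+β′]≡g[x+β] ⟨
        eval t (timesLin β′ h)   ≡⟨ eval-timesLin t β′ h ⟩
        (t +K β′) *K eval t h    ≡⟨ cong (_*K eval t h) (-‿inverseˡ β′) ⟩
        0K *K eval t h           ≡⟨ zeroˡ _ ⟩
        0K                       ∎)
        where open ≡-Reasoning
      divide : ∀ g → eval t g ≡ 0K → Σ Monic (λ h′ → timesLin β′ h′ ≡ g)
      divide []       1≡0  = ⊥-elim (0≢1 (sym 1≡0))
      divide (c ∷ cs) root = syntheticDivision t 1K (c ∷ cs) , timesLinTail-syntheticDivision t β′ (-‿inverseˡ β′) 1K c cs root

  coeffWithLead : K → List K → ℕ → K
  coeffWithLead p cs       zero    = p
  coeffWithLead p []       (suc _) = 0K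
  coeffWithLead p (c ∷ cs) (suc j) = coeffWithLead c cs j

  coeff≡coeffWithLead : ∀ h k → coeff h k ≡ coeffWithLead 1K h k
  coeff≡coeffWithLead h           zero          = refl
  coeff≡coeffWithLead []          (suc k)       = refl
  coeff≡coeffWithLead (a ∷ h)     (suc zero)    = refl
  coeff≡coeffWithLead (a ∷ [])    (suc (suc k)) = refl
  coeff≡coeffWithLead (a ∷ b ∷ h) (suc (suc k)) = coeff≡coeffWithLead (b ∷ h) (suc k)

  coeffWithLead-tail : ∀ p p′ cs j → coeffWithLead p cs (suc j) ≡ coeffWithLead p′ cs (suc j)
  coeffWithLead-tail p p′ []       j = refl
  coeffWithLead-tail p p′ (c ∷ cs) j = refl

  length-timesLinTail : ∀ p β cs → length (timesLinTail p β cs) ≡ suc (length cs)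
  length-timesLinTail p β []       = refl
  length-timesLinTail p β (c ∷ cs) = cong suc (length-timesLinTail c β cs)

  coeffWithLead-timesLinTail : ∀ p β cs j →
    coeffWithLead 1K (timesLinTail p β cs) (suc j) ≡ coeffWithLead p cs (suc j) +K (β *K coeffWithLead p cs j)
  coeffWithLead-timesLinTail p β []       zero    = sym (+-identityˡ _)
  coeffWithLead-timesLinTail p β []       (suc j) = sym (trans (+-identityˡ _) (zeroʳ β))
  coeffWithLead-timesLinTail p β (c ∷ cs) zero    = refl
  coeffWithLead-timesLinTail p β (c ∷ cs) (suc j) =
    trans (coeffWithLead-tail _ 1K (timesLinTail c β cs) j) (coeffWithLead-timesLinTail c β cs j)

  coeff-timesLin : ∀ β h j → coeff (timesLin β h) (suc j) ≡ coeff h (suc j) +K (β *K coeff h j)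
  coeff-timesLin β h j =
    trans (coeff≡coeffWithLead (timesLin β h) (suc j))
          (trans (coeffWithLead-timesLinTail 1K β h j)
                 (sym (cong₂ (λ u v → u +K (β *K v)) (coeff≡coeffWithLead h (suc j)) (coeff≡coeffWithLead h j))))

  coeff-mulM-lin : ∀ β h j → coeff (mulM h (lin β)) (suc j) ≡ coeff h (suc j) +K (β *K coeff h j)
  coeff-mulM-lin β h j = begin
    coeff (mulM h (lin β)) (suc j)
      ≡⟨ coeff-mulM h (lin β) (suc j) ⟩
    ∑< (suc (suc j)) term
      ≡⟨ trans (∑<-snoc (suc j) term) (cong (_+K term (suc j)) (∑<-snoc j term)) ⟩
    (∑< j term +K term j) +K term (suc j)
      ≡⟨ cong₂ (λ u v → (u +K v) +K term (suc j)) (∑<-zero j vanishes) (cong (λ z → coeff h j *K coeff (lin β) z) (ℕP.m+n∸n≡m 1 j)) ⟩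
    (0K +K (coeff h j *K β)) +K term (suc j)
      ≡⟨ cong (λ z → (0K +K (coeff h j *K β)) +K (coeff h (suc j) *K coeff (lin β) z)) (ℕP.n∸n≡0 j) ⟩
    (0K +K (coeff h j *K β)) +K (coeff h (suc j) *K 1K)
      ≡⟨ solve 3 (λ a β b → ((con 0 :+ (a :* β)) :+ (b :* con 1)) := (b :+ (β :* a))) refl (coeff h j) β (coeff h (suc j)) ⟩
    coeff h (suc j) +K (β *K coeff h j) ∎
    where
      open ≡-Reasoning
      term : ℕ → K
      term i = coeff h i *K coeff (lin β) (suc j ∸ i)
      vanishes : ∀ {i} → i < j → term i ≡ 0K
      vanishes {i} i<j = trans (cong (coeff h i *K_) (coeff-beyond (lin β) 1<1+j∸i)) (zeroʳ _)
        where
          1<1+j∸i : 1 < suc j ∸ i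
          1<1+j∸i = subst (1 <_) (sym (ℕP.+-∸-assoc 1 (ℕP.<⇒≤ i<j))) (s≤s (ℕP.m<n⇒0<n∸m i<j))

  mulM-lin : ∀ h β → mulM h (lin β) ≡ timesLin β h
  mulM-lin h β = ≡-by-coeff _ _
    (trans (length-mulM h (lin β)) (trans (ℕP.+-comm (length h) 1) (sym (length-timesLinTail 1K β h))))
    coeffs
    where
      coeffs : ∀ k → coeff (mulM h (lin β)) k ≡ coeff (timesLin β h) k
      coeffs zero    = refl
      coeffs (suc j) = trans (coeff-mulM-lin β h j) (sym (coeff-timesLin β h j))

module Enumeration (𝔽 : FiniteField) (ℓ : ℕ) where
  open FiniteField 𝔽
  open Setup 𝔽 ℓ

  private
    extend : ℕ → K → List Monic
    extend d a = map (a ∷_) (allMonic d)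

  length-∈allMonic : ∀ d {f} → f ∈ allMonic d → length f ≡ d
  length-∈allMonic zero    (here refl) = refl
  length-∈allMonic (suc d) f∈ with ∈-concatMap⁻ (extend d) {xs = elems} f∈
  ... | a∈ = lengths elems a∈
    where
      lengths : ∀ as {f} → Any (λ a → f ∈ extend d a) as → length f ≡ suc d
      lengths (a ∷ as) (here f∈) with ∈-map⁻ (a ∷_) f∈
      ... | g , g∈ , refl = cong suc (length-∈allMonic d g∈)
      lengths (a ∷ as) (there f∈) = lengths as f∈

  ∈-allMonic : ∀ f → f ∈ allMonic (length f)
  ∈-allMonic []      = here refl
  ∈-allMonic (a ∷ f) = ∈-concatMap⁺ (extend (length f)) {xs = elems}
    (Any.map (λ { refl → ∈-map⁺ (a ∷_) (∈-allMonic f) }) (elems-complete a))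

  ∈-allMonic-length : ∀ {f d} → length f ≡ d → f ∈ allMonic d
  ∈-allMonic-length {f} refl = ∈-allMonic f

  allMonic-unique : ∀ d → Unique (allMonic d)
  allMonic-unique zero    = [] ∷ []
  allMonic-unique (suc d) = unique elems elems-unique
    where
      leading : ∀ as {f} → f ∈ concatMap (extend d) as → Σ K (λ a → Σ Monic (λ g → a ∈ as × f ≡ a ∷ g))
      leading (a ∷ as) f∈ with ∈-++⁻ (extend d a) f∈
      ... | inj₁ f∈a with ∈-map⁻ (a ∷_) f∈a
      ...   | g , _ , refl = a , g , here refl , refl
      leading (a ∷ as) f∈ | inj₂ f∈as with leading as f∈as
      ...   | b , g , b∈ , f≡ = b , g , there b∈ , f≡
      unique : ∀ as → Unique as → Unique (concatMap (extend d) as)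
      unique []       _             = []
      unique (a ∷ as) (a∉as ∷ uas) = Unique.++⁺ (Unique.map⁺ (proj₂ ∘′ LP.∷-injective) (allMonic-unique d)) (unique as uas)
        (λ { (f∈a , f∈as) → disjoint f∈a f∈as })
        where
          disjoint : ∀ {f} → f ∈ extend d a → f ∈ concatMap (extend d) as → ⊥
          disjoint f∈a f∈as with ∈-map⁻ (a ∷_) f∈a | leading as f∈as
          ... | g , _ , refl | b , g′ , b∈ , a∷g≡b∷g′ = All.lookup a∉as b∈ (proj₁ (LP.∷-injective a∷g≡b∷g′))

  length-allMonic : ∀ d → length (allMonic d) ≡ q ^ d
  length-allMonic zero    = refl
  length-allMonic (suc d) = lengths elems
    where
      lengths : ∀ as → length (concatMap (extend d) as) ≡ length as ℕ.* q ^ d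
      lengths []       = refl
      lengths (a ∷ as) = trans (LP.length-++ (extend d a))
                               (cong₂ ℕ._+_ (trans (LP.length-map _ (allMonic d)) (length-allMonic d)) (lengths as))

  open SemiringSum ℕP.+-*-isCommutativeSemiring using (∑; ∑-congˡ; ∑-map; ∑-concatMap; ∑-distribˡ)

  ∑-const : ∀ {A : Set} c (xs : List A) → ∑[ _ ← xs ] c ≡ length xs ℕ.* c
  ∑-const c []       = refl
  ∑-const c (x ∷ xs) = cong (c ℕ.+_) (∑-const c xs)

  -- Each monic polynomial of degree j has exactly q^m extensions to degree j + m.
  ∑-allMonic-take : ∀ j m (F : Monic → ℕ) → ∑[ f ← allMonic (j ℕ.+ m) ] F (take j f) ≡ q ^ m ℕ.* ∑ F (allMonic j)
  ∑-allMonic-take zero    m F = begin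
    ∑[ _ ← allMonic m ] F []       ≡⟨ ∑-const (F []) (allMonic m) ⟩
    length (allMonic m) ℕ.* F []   ≡⟨ cong (ℕ._* F []) (length-allMonic m) ⟩
    q ^ m ℕ.* F []                 ≡⟨ cong (q ^ m ℕ.*_) (ℕP.+-identityʳ (F [])) ⟨
    q ^ m ℕ.* (F [] ℕ.+ 0)         ∎
    where open ≡-Reasoning
  ∑-allMonic-take (suc j) m F = begin
    ∑ (F ∘ take (suc j)) (concatMap (extend (j ℕ.+ m)) elems)
      ≡⟨ ∑-concatMap (F ∘ take (suc j)) (extend (j ℕ.+ m)) elems ⟩
    ∑[ a ← elems ] ∑ (F ∘ take (suc j)) (extend (j ℕ.+ m) a)
      ≡⟨ ∑-congˡ elems (λ a → trans (∑-map (F ∘ take (suc j)) (a ∷_) (allMonic (j ℕ.+ m))) (∑-allMonic-take j m (F ∘ (a ∷_)))) ⟩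
    ∑[ a ← elems ] (q ^ m ℕ.* ∑ (F ∘ (a ∷_)) (allMonic j))
      ≡⟨ ∑-distribˡ (q ^ m) _ elems ⟨
    q ^ m ℕ.* ∑[ a ← elems ] ∑ (F ∘ (a ∷_)) (allMonic j)
      ≡⟨ cong (q ^ m ℕ.*_) (trans (∑-concatMap F (extend j) elems) (∑-congˡ elems (λ a → ∑-map F (a ∷_) (allMonic j)))) ⟨
    q ^ m ℕ.* ∑ F (allMonic (suc j)) ∎
    where open ≡-Reasoning

module Classes (𝔽 : FiniteField) (ℓ : ℕ) where
  open FiniteField 𝔽
  open Setup 𝔽 ℓ
  open MonicPolynomials 𝔽 ℓ using (convolution-cong; coeff-mulM; coeff-beyond; ≡-by-coeff; mulM-comm; mulM-assoc; mulM-identityʳ)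
  open Enumeration 𝔽 ℓ

  coeff-toList : ∀ {n} (v : Vec K n) (i : Fin n) → coeff (toList v) (suc (Fin.toℕ i)) ≡ Vec.lookup v i
  coeff-toList (x ∷ v) Fin.zero    = refl
  coeff-toList (x ∷ v) (Fin.suc i) = coeff-toList v i

  cls-ext : ∀ g h → (∀ {j} → j < ℓ → coeff g (suc j) ≡ coeff h (suc j)) → cls g ≡ cls h
  cls-ext g h g≈h = VecP.map-cong (λ i → g≈h (FinP.toℕ<n i)) (Vec.allFin ℓ)

  coeff-toList-cls : ∀ g {j} → j ≤ ℓ → coeff (toList (cls g)) j ≡ coeff g j
  coeff-toList-cls g {zero}  _   = refl
  coeff-toList-cls g {suc j} j<ℓ = begin
    coeff (toList (cls g)) (suc j)              ≡⟨ cong (λ z → coeff (toList (cls g)) (suc z)) (FinP.toℕ-fromℕ< j<ℓ) ⟨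
    coeff (toList (cls g)) (suc (Fin.toℕ i))    ≡⟨ coeff-toList (cls g) i ⟩
    Vec.lookup (cls g) i                        ≡⟨ VecP.lookup-map i (λ i → coeff g (suc (Fin.toℕ i))) (Vec.allFin ℓ) ⟩
    coeff g (suc (Fin.toℕ (Vec.lookup (Vec.allFin ℓ) i))) ≡⟨ cong (λ z → coeff g (suc (Fin.toℕ z))) (VecP.lookup-allFin i) ⟩
    coeff g (suc (Fin.toℕ i))                   ≡⟨ cong (λ z → coeff g (suc z)) (FinP.toℕ-fromℕ< j<ℓ) ⟩
    coeff g (suc j)                             ∎
    where
      open ≡-Reasoning
      i = Fin.fromℕ< j<ℓ

  cls-mulM-cong : ∀ g g′ h h′ → (∀ {i} → i ≤ ℓ → coeff g i ≡ coeff g′ i) → (∀ {i} → i ≤ ℓ → coeff h i ≡ coeff h′ i) →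
                  cls (mulM g h) ≡ cls (mulM g′ h′)
  cls-mulM-cong g g′ h h′ g≈g′ h≈h′ = cls-ext (mulM g h) (mulM g′ h′) (λ {j} j<ℓ →
    trans (coeff-mulM g h (suc j))
          (trans (convolution-cong (suc j) (λ i≤ → g≈g′ (ℕP.≤-trans i≤ j<ℓ)) (λ i≤ → h≈h′ (ℕP.≤-trans i≤ j<ℓ)))
                 (sym (coeff-mulM g′ h′ (suc j)))))

  cls-mulM : ∀ g h → cls (mulM g h) ≡ cls g ·C cls h
  cls-mulM g h = cls-mulM-cong g _ h _ (sym ∘ coeff-toList-cls g) (sym ∘ coeff-toList-cls h)

  cls-toList : ∀ (v : Cls) → cls (toList v) ≡ v
  cls-toList v = trans (VecP.map-cong (coeff-toList v) (Vec.allFin ℓ)) (VecP.map-lookup-allFin v)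

  ·C-assoc : ∀ a b c → (a ·C b) ·C c ≡ a ·C (b ·C c)
  ·C-assoc a b c = begin
    cls (mulM (toList (a ·C b)) (toList c))        ≡⟨ cls-mulM-cong _ _ (toList c) (toList c) (coeff-toList-cls (mulM (toList a) (toList b))) (λ _ → refl) ⟩
    cls (mulM (mulM (toList a) (toList b)) (toList c)) ≡⟨ cong cls (mulM-assoc (toList a) (toList b) (toList c)) ⟩
    cls (mulM (toList a) (mulM (toList b) (toList c))) ≡⟨ cls-mulM-cong (toList a) (toList a) _ _ (λ _ → refl) (sym ∘ coeff-toList-cls (mulM (toList b) (toList c))) ⟩
    cls (mulM (toList a) (toList (b ·C c)))        ∎
    where open ≡-Reasoning

  ·C-comm : ∀ a b → a ·C b ≡ b ·C a
  ·C-comm a b = cong cls (mulM-comm (toList a) (toList b))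

  ·C-identityʳ : ∀ a → a ·C cls [] ≡ a
  ·C-identityʳ a = trans (cls-mulM-cong (toList a) (toList a) _ [] (λ _ → refl) (coeff-toList-cls []))
                         (trans (cong cls (mulM-identityʳ (toList a))) (cls-toList a))

  ·C-identityˡ : ∀ a → cls [] ·C a ≡ a
  ·C-identityˡ a = trans (·C-comm _ a) (·C-identityʳ a)

  cls-injective : ∀ {g h} → length g ≡ ℓ → length h ≡ ℓ → cls g ≡ cls h → g ≡ h
  cls-injective {g} {h} |g|≡ℓ |h|≡ℓ ⟨g⟩≡⟨h⟩ = ≡-by-coeff g h (trans |g|≡ℓ (sym |h|≡ℓ)) coeffs
    where
      coeffs : ∀ k → coeff g k ≡ coeff h k
      coeffs zero = refl
      coeffs (suc j) with j ℕP.<? ℓ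
      ... | yes j<ℓ = trans (sym (coeff-toList-cls g j<ℓ)) (trans (cong (λ v → coeff (toList v) (suc j)) ⟨g⟩≡⟨h⟩) (coeff-toList-cls h j<ℓ))
      ... | no  j≮ℓ = trans (coeff-beyond g (s≤s (subst (_≤ j) (sym |g|≡ℓ) (ℕP.≮⇒≥ j≮ℓ))))
                            (sym (coeff-beyond h (s≤s (subst (_≤ j) (sym |h|≡ℓ) (ℕP.≮⇒≥ j≮ℓ)))))

  allCls-complete : ∀ e → e ∈ allCls
  allCls-complete e = subst (_∈ allCls) (cls-toList e) (∈-map⁺ cls (∈-allMonic-length {toList e} (VecP.length-toList e)))

  allCls-unique : Unique allCls
  allCls-unique = Unique-map⁺-∈ cls (λ g∈ h∈ → cls-injective (length-∈allMonic ℓ g∈) (length-∈allMonic ℓ h∈)) (allMonic-unique ℓ)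

  coeff-take : ∀ n f {k} → k ≤ n → coeff (take n f) k ≡ coeff f k
  coeff-take n       f       {zero}        _       = refl
  coeff-take (suc n) []      {suc k}       _       = refl
  coeff-take (suc n) (a ∷ f) {suc zero}    _       = refl
  coeff-take (suc n) (a ∷ f) {suc (suc k)} (s≤s p) = coeff-take n f p

  cls-take : ∀ f → cls (take ℓ f) ≡ cls f
  cls-take f = cls-ext (take ℓ f) f (coeff-take ℓ f)

  open Sum ℕP.+-0-isCommutativeMonoid

  -- The class of f depends only on its first ℓ coefficients, which range freely over K^ℓ.
  length-filter-cls-allMonic : ∀ m ε → length (filter (λ f → cls f ≟C ε) (allMonic (ℓ ℕ.+ m))) ≡ q ^ m
  length-filter-cls-allMonic m ε = begin
    length (filter inε? (allMonic (ℓ ℕ.+ m)))     ≡⟨ length-filter≡∑ inε? (allMonic (ℓ ℕ.+ m)) ⟩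
    ∑ (indicator inε?) (allMonic (ℓ ℕ.+ m))       ≡⟨ ∑-congˡ (allMonic (ℓ ℕ.+ m)) (λ f → cong (indicator (_≟C ε)) (sym (cls-take f))) ⟩
    ∑[ f ← allMonic (ℓ ℕ.+ m) ] indicator inε? (take ℓ f) ≡⟨ ∑-allMonic-take ℓ m (indicator inε?) ⟩
    q ^ m ℕ.* ∑ (indicator inε?) (allMonic ℓ)     ≡⟨ cong (q ^ m ℕ.*_) (∑-map (indicator (_≟C ε)) cls (allMonic ℓ)) ⟨
    q ^ m ℕ.* ∑ (indicator (_≟C ε)) allCls       ≡⟨ cong (q ^ m ℕ.*_) (∑-δ′ ℕP.+-0-isCommutativeMonoid _≟C_ (λ _ → 1) allCls-unique (allCls-complete ε)) ⟩
    q ^ m ℕ.* 1                                   ≡⟨ ℕP.*-identityʳ _ ⟩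
    q ^ m                                         ∎
    where
      open ≡-Reasoning
      inε? = λ f → cls f ≟C ε

module Divisibility (𝔽 : FiniteField) (ℓ : ℕ) where
  open FiniteField 𝔽
  open Setup 𝔽 ℓ
  open MonicPolynomials 𝔽 ℓ using (length-mulM; mulM-comm; mulM-assoc)
  open LinearFactors 𝔽 ℓ using (mulM-lin; timesLin-coprime)
  open Enumeration 𝔽 ℓ

  Divides⇒quotient : ∀ {g f} → Divides g f → Σ Monic (λ h → h ∈ allMonic (length f ∸ length g) × mulM h g ≡ f)
  Divides⇒quotient (_ , h∈) = find h∈

  quotient⇒Divides : ∀ {g f} h → mulM h g ≡ f → Divides g f
  quotient⇒Divides {g} h refl = |g|≤|hg| , lose (∈-allMonic-length |hg|∸|g|≡|h|) refl
    where
      |hg|≡ : length (mulM h g) ≡ length g ℕ.+ length h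
      |hg|≡ = trans (length-mulM h g) (ℕP.+-comm (length h) (length g))
      |g|≤|hg| : length g ≤ length (mulM h g)
      |g|≤|hg| = subst (length g ≤_) (sym |hg|≡) (ℕP.m≤m+n (length g) (length h))
      |hg|∸|g|≡|h| : length h ≡ length (mulM h g) ∸ length g
      |hg|∸|g|≡|h| = sym (trans (cong (_∸ length g) |hg|≡) (ℕP.m+n∸m≡n (length g) (length h)))

  Divides-mulMʳ : ∀ {g f} k → Divides g f → Divides g (mulM f k)
  Divides-mulMʳ {g} k g∣f with Divides⇒quotient g∣f
  ... | h , _ , refl = quotient⇒Divides (mulM h k)
    (trans (mulM-assoc h k g) (trans (cong (mulM h) (mulM-comm k g)) (sym (mulM-assoc h g k))))

  lin∣mulM-lin : ∀ {β β′ h} → β ≢ β′ → Divides (lin β′) (mulM h (lin β)) → Divides (lin β′) h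
  lin∣mulM-lin {β} {β′} {h} β≢β′ x+β′∣h[x+β] with Divides⇒quotient x+β′∣h[x+β]
  ... | h₁ , _ , h₁[x+β′]≡h[x+β] with timesLin-coprime β≢β′ (trans (sym (mulM-lin h₁ β′)) (trans h₁[x+β′]≡h[x+β] (mulM-lin h β)))
  ...   | h₂ , h₂[x+β′]≡h = quotient⇒Divides h₂ (trans (mulM-lin h₂ β′) h₂[x+β′]≡h)

  lin∤1 : ∀ β → ¬ Divides (lin β) []
  lin∤1 β (() , _)

-- Setup.toℚ n unfolds to ℤ.+ n ℚ./ 1; the facts about it are stated in that form, outside Setup.
n/1≡mkℚ : ∀ n → ℤ.+ n ℚ./ 1 ≡ ℚ.mkℚ (ℤ.+ n) 0 (Coprimality.sym (Coprimality.1-coprimeTo n))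
n/1≡mkℚ n = ℚP.normalize-coprime (Coprimality.sym (Coprimality.1-coprimeTo n))

n/1-+ : ∀ m n → ℤ.+ (m ℕ.+ n) ℚ./ 1 ≡ ℤ.+ m ℚ./ 1 + ℤ.+ n ℚ./ 1
n/1-+ m n = begin
  ℤ.+ (m ℕ.+ n) ℚ./ 1                                       ≡⟨ ℚP./-cong (sym (cong₂ ℤ._+_ (ℤP.*-identityʳ (ℤ.+ m)) (ℤP.*-identityʳ (ℤ.+ n)))) refl ⟩
  ((ℤ.+ m) ℤ.* (ℤ.+ 1) ℤ.+ (ℤ.+ n) ℤ.* (ℤ.+ 1)) ℚ./ (1 ℕ.* 1) ≡⟨ cong₂ _+_ (n/1≡mkℚ m) (n/1≡mkℚ n) ⟨
  ℤ.+ m ℚ./ 1 + ℤ.+ n ℚ./ 1                                 ∎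
  where open ≡-Reasoning

n/1*1/n≡1 : ∀ n .{{_ : NonZero n}} → (ℤ.+ n ℚ./ 1) * (ℤ.+ 1 ℚ./ n) ≡ 1ℚ
n/1*1/n≡1 (suc k) = trans (cong₂ _*_ (n/1≡mkℚ (suc k)) (ℚP.normalize-coprime (Coprimality.1-coprimeTo (suc k))))
                          (ℚP.*-inverseʳ (ℚ.mkℚ (ℤ.+ (suc k)) 0 (Coprimality.sym (Coprimality.1-coprimeTo (suc k)))))

module ℚSum = SemiringSum (IsCommutativeRing.isCommutativeSemiring ℚP.+-*-isCommutativeRing)
module ℕSum = Sum ℕP.+-0-isCommutativeMonoid

n/1-∑ : ∀ {A : Set} (f : A → ℕ) xs → ℤ.+ (ℕSum.∑ f xs) ℚ./ 1 ≡ ℚSum.∑[ x ← xs ] (ℤ.+ f x ℚ./ 1)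
n/1-∑ f []       = refl
n/1-∑ f (x ∷ xs) = trans (n/1-+ (f x) _) (cong ((ℤ.+ f x ℚ./ 1) +_) (n/1-∑ f xs))

module GroupAlgebra (𝔽 : FiniteField) (ℓ : ℕ) where
  open FiniteField 𝔽
  open Setup 𝔽 ℓ
  open Classes 𝔽 ℓ
  open ℚSum
  private module ℚR = IsCommutativeRing ℚP.+-*-isCommutativeRing

  infix 4 _≈ᴱ_
  _≈ᴱ_ : QE → QE → Set
  a ≈ᴱ b = ∀ ε → a ε ≡ b ε

  ∑ℰ : (Cls → ℚ) → ℚ
  ∑ℰ f = ∑ f allCls

  syntax ∑ℰ (λ e → b) = ∑ℰ[ e ] b

  ∑ℰ-cong : ∀ {f g : Cls → ℚ} → (∀ e → f e ≡ g e) → ∑ℰ f ≡ ∑ℰ g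
  ∑ℰ-cong = ∑-congˡ allCls

  ∑ℰ-comm : ∀ (f : Cls → Cls → ℚ) → ∑ℰ[ x ] ∑ℰ[ y ] f x y ≡ ∑ℰ[ y ] ∑ℰ[ x ] f x y
  ∑ℰ-comm f = ∑-comm f allCls allCls

  ∑ℰ-δ : ∀ (f : Cls → ℚ) x → ∑ℰ[ y ] when ⌊ x ≟C y ⌋ (f y) ≡ f x
  ∑ℰ-δ f x = ∑-δ ℚR.+-isCommutativeMonoid _≟C_ f allCls-unique (allCls-complete x)

  ∑ℰ-δ′ : ∀ (f : Cls → ℚ) x → ∑ℰ[ y ] when ⌊ y ≟C x ⌋ (f y) ≡ f x
  ∑ℰ-δ′ f x = ∑-δ′ ℚR.+-isCommutativeMonoid _≟C_ f allCls-unique (allCls-complete x)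

  sumQE-apply : ∀ {A : Set} (F : A → QE) xs ε → sumQE (map F xs) ε ≡ ∑[ x ← xs ] F x ε
  sumQE-apply F []       ε = refl
  sumQE-apply F (x ∷ xs) ε = cong (F x ε +_) (sumQE-apply F xs ε)

  ⊛-cong : ∀ {a a′ b b′} → a ≈ᴱ a′ → b ≈ᴱ b′ → a ⊛ b ≈ᴱ a′ ⊛ b′
  ⊛-cong a≈ b≈ ε = ∑ℰ-cong (λ x → ∑ℰ-cong (λ y → cong (when ⌊ (x ·C y) ≟C ε ⌋) (cong₂ _*_ (a≈ x) (b≈ y))))

  ⊛-distribʳ : ∀ a a′ b → (a ⊕ a′) ⊛ b ≈ᴱ (a ⊛ b) ⊕ (a′ ⊛ b)
  ⊛-distribʳ a a′ b ε = trans (∑ℰ-cong (λ x → trans (∑ℰ-cong (λ y →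
      trans (cong (when ⌊ (x ·C y) ≟C ε ⌋) (ℚR.distribʳ (b y) (a x) (a′ x))) (when-+ ⌊ (x ·C y) ≟C ε ⌋ _ _)))
      (∑-∙ _ _ allCls)))
    (∑-∙ _ _ allCls)

  ⊛-distribˡ : ∀ a b b′ → a ⊛ (b ⊕ b′) ≈ᴱ (a ⊛ b) ⊕ (a ⊛ b′)
  ⊛-distribˡ a b b′ ε = trans (∑ℰ-cong (λ x → trans (∑ℰ-cong (λ y →
      trans (cong (when ⌊ (x ·C y) ≟C ε ⌋) (ℚR.distribˡ (a x) (b y) (b′ y))) (when-+ ⌊ (x ·C y) ≟C ε ⌋ _ _)))
      (∑-∙ _ _ allCls)))
    (∑-∙ _ _ allCls)

  ⊛-zeroˡ : ∀ b → zeroQE ⊛ b ≈ᴱ zeroQE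
  ⊛-zeroˡ b ε = ∑-zero allCls (λ {x} _ → ∑-zero allCls (λ {y} _ →
    trans (cong (when ⌊ (x ·C y) ≟C ε ⌋) (ℚR.zeroˡ (b y))) (when-0 ⌊ (x ·C y) ≟C ε ⌋)))

  ⊛-zeroʳ : ∀ a → a ⊛ zeroQE ≈ᴱ zeroQE
  ⊛-zeroʳ a ε = ∑-zero allCls (λ {x} _ → ∑-zero allCls (λ {y} _ →
    trans (cong (when ⌊ (x ·C y) ≟C ε ⌋) (ℚR.zeroʳ (a x))) (when-0 ⌊ (x ·C y) ≟C ε ⌋)))

  ⊛-scaleˡ : ∀ c a b → scaleQE c a ⊛ b ≈ᴱ scaleQE c (a ⊛ b)
  ⊛-scaleˡ c a b ε = trans (∑ℰ-cong (λ x → trans (∑ℰ-cong (λ y →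
      trans (cong (when ⌊ (x ·C y) ≟C ε ⌋) (ℚR.*-assoc c (a x) (b y))) (when-*ˡ ⌊ (x ·C y) ≟C ε ⌋ c _)))
      (sym (∑-distribˡ c _ allCls))))
    (sym (∑-distribˡ c _ allCls))

  ⊛-scaleʳ : ∀ c a b → a ⊛ scaleQE c b ≈ᴱ scaleQE c (a ⊛ b)
  ⊛-scaleʳ c a b ε = trans (∑ℰ-cong (λ x → trans (∑ℰ-cong (λ y →
      trans (cong (when ⌊ (x ·C y) ≟C ε ⌋) (swap (a x) (b y))) (when-*ˡ ⌊ (x ·C y) ≟C ε ⌋ c _)))
      (sym (∑-distribˡ c _ allCls))))
    (sym (∑-distribˡ c _ allCls))
    where
      swap : ∀ u v → u * (c * v) ≡ c * (u * v)
      swap u v = trans (sym (ℚR.*-assoc u c v)) (trans (cong (_* v) (ℚR.*-comm u c)) (ℚR.*-assoc c u v))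

  ⟪⟫-⊛ : ∀ a b → ⟪ a ⟫ ⊛ ⟪ b ⟫ ≈ᴱ ⟪ a ·C b ⟫
  ⟪⟫-⊛ a b ε = begin
    ∑ℰ[ x ] ∑ℰ[ y ] when ⌊ (x ·C y) ≟C ε ⌋ (⟪ a ⟫ x * ⟪ b ⟫ y)
      ≡⟨ ∑ℰ-cong (λ x → ∑ℰ-cong (λ y → basis ⌊ (x ·C y) ≟C ε ⌋ ⌊ a ≟C x ⌋ ⌊ b ≟C y ⌋)) ⟩
    ∑ℰ[ x ] ∑ℰ[ y ] when ⌊ a ≟C x ⌋ (when ⌊ b ≟C y ⌋ (when ⌊ (x ·C y) ≟C ε ⌋ 1ℚ))
      ≡⟨ ∑ℰ-cong (λ x → sym (when-∑ ⌊ a ≟C x ⌋ _ allCls)) ⟩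
    ∑ℰ[ x ] when ⌊ a ≟C x ⌋ (∑ℰ[ y ] when ⌊ b ≟C y ⌋ (when ⌊ (x ·C y) ≟C ε ⌋ 1ℚ))
      ≡⟨ ∑ℰ-δ (λ x → ∑ℰ[ y ] when ⌊ b ≟C y ⌋ (when ⌊ (x ·C y) ≟C ε ⌋ 1ℚ)) a ⟩
    ∑ℰ[ y ] when ⌊ b ≟C y ⌋ (when ⌊ (a ·C y) ≟C ε ⌋ 1ℚ)
      ≡⟨ ∑ℰ-δ (λ y → when ⌊ (a ·C y) ≟C ε ⌋ 1ℚ) b ⟩
    when ⌊ (a ·C b) ≟C ε ⌋ 1ℚ ∎
    where
      open ≡-Reasoning
      basis : ∀ c d d′ → when c (when d 1ℚ * when d′ 1ℚ) ≡ when d (when d′ (when c 1ℚ))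
      basis false false false = refl
      basis false false true  = refl
      basis false true  false = refl
      basis false true  true  = refl
      basis true  false false = refl
      basis true  false true  = refl
      basis true  true  false = refl
      basis true  true  true  = refl

  ⊛-identityʳ : ∀ a → a ⊛ ⟨ [] ⟩ ≈ᴱ a
  ⊛-identityʳ a ε = begin
    ∑ℰ[ x ] ∑ℰ[ y ] when ⌊ (x ·C y) ≟C ε ⌋ (a x * ⟨ [] ⟩ y)
      ≡⟨ ∑ℰ-cong (λ x → ∑ℰ-cong (λ y → unit ⌊ (x ·C y) ≟C ε ⌋ ⌊ cls [] ≟C y ⌋ (a x))) ⟩
    ∑ℰ[ x ] ∑ℰ[ y ] when ⌊ cls [] ≟C y ⌋ (when ⌊ (x ·C y) ≟C ε ⌋ (a x))
      ≡⟨ ∑ℰ-cong (λ x → ∑ℰ-δ (λ y → when ⌊ (x ·C y) ≟C ε ⌋ (a x)) (cls [])) ⟩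
    ∑ℰ[ x ] when ⌊ (x ·C cls []) ≟C ε ⌋ (a x)
      ≡⟨ ∑ℰ-cong (λ x → cong (λ z → when ⌊ z ≟C ε ⌋ (a x)) (·C-identityʳ x)) ⟩
    ∑ℰ[ x ] when ⌊ x ≟C ε ⌋ (a x)
      ≡⟨ ∑ℰ-δ′ a ε ⟩
    a ε ∎
    where
      open ≡-Reasoning
      unit : ∀ c d u → when c (u * when d 1ℚ) ≡ when d (when c u)
      unit false false u = refl
      unit false true  u = refl
      unit true  false u = ℚR.zeroʳ u
      unit true  true  u = ℚR.*-identityʳ u

  ⊛-identityˡ : ∀ b → ⟨ [] ⟩ ⊛ b ≈ᴱ b
  ⊛-identityˡ b ε = begin
    ∑ℰ[ x ] ∑ℰ[ y ] when ⌊ (x ·C y) ≟C ε ⌋ (⟨ [] ⟩ x * b y)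
      ≡⟨ ∑ℰ-cong (λ x → ∑ℰ-cong (λ y → unit ⌊ (x ·C y) ≟C ε ⌋ ⌊ cls [] ≟C x ⌋ (b y))) ⟩
    ∑ℰ[ x ] ∑ℰ[ y ] when ⌊ cls [] ≟C x ⌋ (when ⌊ (x ·C y) ≟C ε ⌋ (b y))
      ≡⟨ ∑ℰ-cong (λ x → sym (when-∑ ⌊ cls [] ≟C x ⌋ _ allCls)) ⟩
    ∑ℰ[ x ] when ⌊ cls [] ≟C x ⌋ (∑ℰ[ y ] when ⌊ (x ·C y) ≟C ε ⌋ (b y))
      ≡⟨ ∑ℰ-δ (λ x → ∑ℰ[ y ] when ⌊ (x ·C y) ≟C ε ⌋ (b y)) (cls []) ⟩
    ∑ℰ[ y ] when ⌊ (cls [] ·C y) ≟C ε ⌋ (b y)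
      ≡⟨ ∑ℰ-cong (λ y → cong (λ z → when ⌊ z ≟C ε ⌋ (b y)) (·C-identityˡ y)) ⟩
    ∑ℰ[ y ] when ⌊ y ≟C ε ⌋ (b y)
      ≡⟨ ∑ℰ-δ′ b ε ⟩
    b ε ∎
    where
      open ≡-Reasoning
      unit : ∀ c d u → when c (when d 1ℚ * u) ≡ when d (when c u)
      unit false false u = refl
      unit false true  u = refl
      unit true  false u = ℚR.zeroˡ u
      unit true  true  u = ℚR.*-identityˡ u

  ⊛⊛-expandˡ : ∀ a b c ε → ((a ⊛ b) ⊛ c) ε ≡ ∑ℰ[ x ] ∑ℰ[ y ] ∑ℰ[ w ] when ⌊ ((x ·C y) ·C w) ≟C ε ⌋ ((a x * b y) * c w)
  ⊛⊛-expandˡ a b c ε = begin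
    ∑ℰ[ u ] ∑ℰ[ w ] when ⌊ (u ·C w) ≟C ε ⌋ ((a ⊛ b) u * c w)
      ≡⟨ ∑ℰ-cong (λ u → ∑ℰ-cong (λ w → expand u w)) ⟩
    ∑ℰ[ u ] ∑ℰ[ w ] ∑ℰ[ x ] ∑ℰ[ y ] T u w x y
      ≡⟨ ∑ℰ-cong (λ u → ∑ℰ-comm (λ w x → ∑ℰ[ y ] T u w x y)) ⟩
    ∑ℰ[ u ] ∑ℰ[ x ] ∑ℰ[ w ] ∑ℰ[ y ] T u w x y
      ≡⟨ ∑ℰ-cong (λ u → ∑ℰ-cong (λ x → ∑ℰ-comm (λ w y → T u w x y))) ⟩
    ∑ℰ[ u ] ∑ℰ[ x ] ∑ℰ[ y ] ∑ℰ[ w ] T u w x y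
      ≡⟨ ∑ℰ-comm (λ u x → ∑ℰ[ y ] ∑ℰ[ w ] T u w x y) ⟩
    ∑ℰ[ x ] ∑ℰ[ u ] ∑ℰ[ y ] ∑ℰ[ w ] T u w x y
      ≡⟨ ∑ℰ-cong (λ x → ∑ℰ-comm (λ u y → ∑ℰ[ w ] T u w x y)) ⟩
    ∑ℰ[ x ] ∑ℰ[ y ] ∑ℰ[ u ] ∑ℰ[ w ] T u w x y
      ≡⟨ ∑ℰ-cong (λ x → ∑ℰ-cong (λ y → ∑ℰ-comm (λ u w → T u w x y))) ⟩
    ∑ℰ[ x ] ∑ℰ[ y ] ∑ℰ[ w ] ∑ℰ[ u ] T u w x y
      ≡⟨ ∑ℰ-cong (λ x → ∑ℰ-cong (λ y → ∑ℰ-cong (λ w → ∑ℰ-δ (λ u → when ⌊ (u ·C w) ≟C ε ⌋ ((a x * b y) * c w)) (x ·C y)))) ⟩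
    ∑ℰ[ x ] ∑ℰ[ y ] ∑ℰ[ w ] when ⌊ ((x ·C y) ·C w) ≟C ε ⌋ ((a x * b y) * c w) ∎
    where
      open ≡-Reasoning
      T : Cls → Cls → Cls → Cls → ℚ
      T u w x y = when ⌊ (x ·C y) ≟C u ⌋ (when ⌊ (u ·C w) ≟C ε ⌋ ((a x * b y) * c w))
      expand : ∀ u w → when ⌊ (u ·C w) ≟C ε ⌋ ((a ⊛ b) u * c w) ≡ ∑ℰ[ x ] ∑ℰ[ y ] T u w x y
      expand u w = begin
        when U (∑ℰ[ x ] ∑ℰ[ y ] when ⌊ (x ·C y) ≟C u ⌋ (a x * b y) * c w)
          ≡⟨ cong (when U) (trans (∑-distribʳ (c w) _ allCls) (∑ℰ-cong (λ x → ∑-distribʳ (c w) _ allCls))) ⟩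
        when U (∑ℰ[ x ] ∑ℰ[ y ] (when ⌊ (x ·C y) ≟C u ⌋ (a x * b y) * c w))
          ≡⟨ trans (when-∑ U _ allCls) (∑ℰ-cong (λ x → when-∑ U _ allCls)) ⟩
        ∑ℰ[ x ] ∑ℰ[ y ] when U (when ⌊ (x ·C y) ≟C u ⌋ (a x * b y) * c w)
          ≡⟨ ∑ℰ-cong (λ x → ∑ℰ-cong (λ y → trans (cong (when U) (sym (when-*ʳ ⌊ (x ·C y) ≟C u ⌋ (a x * b y) (c w))))
                                                 (when-comm U ⌊ (x ·C y) ≟C u ⌋ _))) ⟩
        ∑ℰ[ x ] ∑ℰ[ y ] T u w x y ∎
        where U = ⌊ (u ·C w) ≟C ε ⌋

  ⊛⊛-expandʳ : ∀ a b c ε → (a ⊛ (b ⊛ c)) ε ≡ ∑ℰ[ x ] ∑ℰ[ y ] ∑ℰ[ w ] when ⌊ (x ·C (y ·C w)) ≟C ε ⌋ (a x * (b y * c w))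
  ⊛⊛-expandʳ a b c ε = begin
    ∑ℰ[ x ] ∑ℰ[ v ] when ⌊ (x ·C v) ≟C ε ⌋ (a x * (b ⊛ c) v)
      ≡⟨ ∑ℰ-cong (λ x → ∑ℰ-cong (λ v → expand x v)) ⟩
    ∑ℰ[ x ] ∑ℰ[ v ] ∑ℰ[ y ] ∑ℰ[ w ] T x v y w
      ≡⟨ ∑ℰ-cong (λ x → ∑ℰ-comm (λ v y → ∑ℰ[ w ] T x v y w)) ⟩
    ∑ℰ[ x ] ∑ℰ[ y ] ∑ℰ[ v ] ∑ℰ[ w ] T x v y w
      ≡⟨ ∑ℰ-cong (λ x → ∑ℰ-cong (λ y → ∑ℰ-comm (λ v w → T x v y w))) ⟩
    ∑ℰ[ x ] ∑ℰ[ y ] ∑ℰ[ w ] ∑ℰ[ v ] T x v y w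
      ≡⟨ ∑ℰ-cong (λ x → ∑ℰ-cong (λ y → ∑ℰ-cong (λ w → ∑ℰ-δ (λ v → when ⌊ (x ·C v) ≟C ε ⌋ (a x * (b y * c w))) (y ·C w)))) ⟩
    ∑ℰ[ x ] ∑ℰ[ y ] ∑ℰ[ w ] when ⌊ (x ·C (y ·C w)) ≟C ε ⌋ (a x * (b y * c w)) ∎
    where
      open ≡-Reasoning
      T : Cls → Cls → Cls → Cls → ℚ
      T x v y w = when ⌊ (y ·C w) ≟C v ⌋ (when ⌊ (x ·C v) ≟C ε ⌋ (a x * (b y * c w)))
      expand : ∀ x v → when ⌊ (x ·C v) ≟C ε ⌋ (a x * (b ⊛ c) v) ≡ ∑ℰ[ y ] ∑ℰ[ w ] T x v y w
      expand x v = begin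
        when V (a x * ∑ℰ[ y ] ∑ℰ[ w ] when ⌊ (y ·C w) ≟C v ⌋ (b y * c w))
          ≡⟨ cong (when V) (trans (∑-distribˡ (a x) _ allCls) (∑ℰ-cong (λ y → ∑-distribˡ (a x) _ allCls))) ⟩
        when V (∑ℰ[ y ] ∑ℰ[ w ] (a x * when ⌊ (y ·C w) ≟C v ⌋ (b y * c w)))
          ≡⟨ trans (when-∑ V _ allCls) (∑ℰ-cong (λ y → when-∑ V _ allCls)) ⟩
        ∑ℰ[ y ] ∑ℰ[ w ] when V (a x * when ⌊ (y ·C w) ≟C v ⌋ (b y * c w))
          ≡⟨ ∑ℰ-cong (λ y → ∑ℰ-cong (λ w → trans (cong (when V) (sym (when-*ˡ ⌊ (y ·C w) ≟C v ⌋ (a x) (b y * c w))))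
                                                 (when-comm V ⌊ (y ·C w) ≟C v ⌋ _))) ⟩
        ∑ℰ[ y ] ∑ℰ[ w ] T x v y w ∎
        where V = ⌊ (x ·C v) ≟C ε ⌋

  ⊛-assoc : ∀ a b c → (a ⊛ b) ⊛ c ≈ᴱ a ⊛ (b ⊛ c)
  ⊛-assoc a b c ε = trans (⊛⊛-expandˡ a b c ε) (trans
    (∑ℰ-cong (λ x → ∑ℰ-cong (λ y → ∑ℰ-cong (λ w →
      cong₂ (λ z t → when ⌊ z ≟C ε ⌋ t) (·C-assoc x y w) (ℚR.*-assoc (a x) (b y) (c w))))))
    (sym (⊛⊛-expandʳ a b c ε)))

  sumQE-⊛ : ∀ {A : Set} (F : A → QE) xs c → sumQE (map F xs) ⊛ c ≈ᴱ sumQE (map (λ x → F x ⊛ c) xs)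
  sumQE-⊛ F []       c = ⊛-zeroˡ c
  sumQE-⊛ F (x ∷ xs) c ε = trans (⊛-distribʳ (F x) _ c ε) (cong ((F x ⊛ c) ε +_) (sumQE-⊛ F xs c ε))

  ⊛-sumQE : ∀ {A : Set} (F : A → QE) xs c → c ⊛ sumQE (map F xs) ≈ᴱ sumQE (map (λ x → c ⊛ F x) xs)
  ⊛-sumQE F []       c = ⊛-zeroʳ c
  ⊛-sumQE F (x ∷ xs) c ε = trans (⊛-distribˡ c (F x) _ ε) (cong ((c ⊛ F x) ε +_) (⊛-sumQE F xs c ε))

  ⟨⟩-⊛ : ∀ f g → ⟨ f ⟩ ⊛ ⟨ g ⟩ ≈ᴱ ⟨ mulM f g ⟩
  ⟨⟩-⊛ f g ε = trans (⟪⟫-⊛ (cls f) (cls g) ε) (cong (λ e → when ⌊ e ≟C ε ⌋ 1ℚ) (sym (cls-mulM f g)))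

  ⟦_⟧ : List Monic → QE
  ⟦ fs ⟧ = sumQE (map ⟨_⟩ fs)

  ⟦⟧-⊛ʳ : ∀ fs g → ⟦ fs ⟧ ⊛ ⟨ g ⟩ ≈ᴱ ⟦ map (λ f → mulM f g) fs ⟧
  ⟦⟧-⊛ʳ fs g ε = begin
    (⟦ fs ⟧ ⊛ ⟨ g ⟩) ε                          ≡⟨ sumQE-⊛ ⟨_⟩ fs ⟨ g ⟩ ε ⟩
    sumQE (map (λ f → ⟨ f ⟩ ⊛ ⟨ g ⟩) fs) ε       ≡⟨ sumQE-apply (λ f → ⟨ f ⟩ ⊛ ⟨ g ⟩) fs ε ⟩
    ∑[ f ← fs ] (⟨ f ⟩ ⊛ ⟨ g ⟩) ε                ≡⟨ ∑-congˡ fs (λ f → ⟨⟩-⊛ f g ε) ⟩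
    ∑[ f ← fs ] ⟨ mulM f g ⟩ ε                   ≡⟨ ∑-map (λ h → ⟨ h ⟩ ε) (λ f → mulM f g) fs ⟨
    ∑[ h ← map (λ f → mulM f g) fs ] ⟨ h ⟩ ε     ≡⟨ sumQE-apply ⟨_⟩ (map (λ f → mulM f g) fs) ε ⟨
    ⟦ map (λ f → mulM f g) fs ⟧ ε                ∎
    where open ≡-Reasoning

  ⟨⟩-⊛-⟦⟧ : ∀ g fs → ⟨ g ⟩ ⊛ ⟦ fs ⟧ ≈ᴱ ⟦ map (mulM g) fs ⟧
  ⟨⟩-⊛-⟦⟧ g fs ε = begin
    (⟨ g ⟩ ⊛ ⟦ fs ⟧) ε                          ≡⟨ ⊛-sumQE ⟨_⟩ fs ⟨ g ⟩ ε ⟩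
    sumQE (map (λ f → ⟨ g ⟩ ⊛ ⟨ f ⟩) fs) ε       ≡⟨ sumQE-apply (λ f → ⟨ g ⟩ ⊛ ⟨ f ⟩) fs ε ⟩
    ∑[ f ← fs ] (⟨ g ⟩ ⊛ ⟨ f ⟩) ε                ≡⟨ ∑-congˡ fs (λ f → ⟨⟩-⊛ g f ε) ⟩
    ∑[ f ← fs ] ⟨ mulM g f ⟩ ε                   ≡⟨ ∑-map (λ h → ⟨ h ⟩ ε) (mulM g) fs ⟨
    ∑[ h ← map (mulM g) fs ] ⟨ h ⟩ ε             ≡⟨ sumQE-apply ⟨_⟩ (map (mulM g) fs) ε ⟨
    ⟦ map (mulM g) fs ⟧ ε                        ∎
    where open ≡-Reasoning

  ⟦⟧-apply : ∀ fs ε → ⟦ fs ⟧ ε ≡ toℚ (length (filter (λ f → cls f ≟C ε) fs))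
  ⟦⟧-apply fs ε = begin
    ⟦ fs ⟧ ε                                     ≡⟨ sumQE-apply ⟨_⟩ fs ε ⟩
    ∑[ f ← fs ] ⟨ f ⟩ ε                          ≡⟨ ∑-congˡ fs indicator≡ ⟩
    ∑[ f ← fs ] toℚ (indicator inε? f)           ≡⟨ n/1-∑ (indicator inε?) fs ⟨
    toℚ (ℕSum.∑ (indicator inε?) fs)             ≡⟨ cong toℚ (length-filter≡∑ inε? fs) ⟨
    toℚ (length (filter inε? fs))                ∎
    where
      open ≡-Reasoning
      inε? = λ f → cls f ≟C ε
      indicator≡ : ∀ f → ⟨ f ⟩ ε ≡ toℚ (indicator inε? f)
      indicator≡ f with cls f ≟C ε
      ... | yes _ = refl
      ... | no _  = refl

module PowerSeries (𝔽 : FiniteField) (ℓ : ℕ) where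
  open FiniteField 𝔽
  open Setup 𝔽 ℓ
  open GroupAlgebra 𝔽 ℓ
  open ℚSum

  ≋-refl : ∀ {A} → A ≋ A
  ≋-refl n ε = refl

  ≋-sym : ∀ {A B} → A ≋ B → B ≋ A
  ≋-sym A≋B n ε = sym (A≋B n ε)

  ≋-trans : ∀ {A B C} → A ≋ B → B ≋ C → A ≋ C
  ≋-trans A≋B B≋C n ε = trans (A≋B n ε) (B≋C n ε)

  ≋-setoid : Setoid _ _
  ≋-setoid = record { Carrier = PS ; _≈_ = _≋_ ; isEquivalence = record { refl = λ {A} → ≋-refl {A} ; sym = ≋-sym ; trans = ≋-trans } }

  ⊛ₛ-apply : ∀ A B n ε → (A ⊛ₛ B) n ε ≡ ∑< (suc n) (λ k → (A k ⊛ B (n ∸ k)) ε)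
  ⊛ₛ-apply A B n ε = trans (sumQE-apply (λ k → A k ⊛ B (n ∸ k)) (upTo (suc n)) ε) (∑-upTo (λ k → (A k ⊛ B (n ∸ k)) ε) (suc n))

  ⊛ₛ-cong : ∀ {A A′ B B′} → A ≋ A′ → B ≋ B′ → (A ⊛ₛ B) ≋ (A′ ⊛ₛ B′)
  ⊛ₛ-cong {A} {A′} {B} {B′} A≋ B≋ n ε = trans (⊛ₛ-apply A B n ε)
    (trans (∑<-cong (suc n) (λ {k} _ → ⊛-cong (A≋ k) (B≋ (n ∸ k)) ε)) (sym (⊛ₛ-apply A′ B′ n ε)))

  ⊛ₛ-congˡ : ∀ {A A′} B → A ≋ A′ → (A ⊛ₛ B) ≋ (A′ ⊛ₛ B)
  ⊛ₛ-congˡ B A≋ = ⊛ₛ-cong A≋ (≋-refl {B})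

  ⊛ₛ-congʳ : ∀ A {B B′} → B ≋ B′ → (A ⊛ₛ B) ≋ (A ⊛ₛ B′)
  ⊛ₛ-congʳ A B≋ = ⊛ₛ-cong (≋-refl {A}) B≋

  ⊛ₛ-assoc : ∀ A B C → ((A ⊛ₛ B) ⊛ₛ C) ≋ (A ⊛ₛ (B ⊛ₛ C))
  ⊛ₛ-assoc A B C n ε = begin
    ((A ⊛ₛ B) ⊛ₛ C) n ε
      ≡⟨ ⊛ₛ-apply (A ⊛ₛ B) C n ε ⟩
    ∑< (suc n) (λ m → ((A ⊛ₛ B) m ⊛ C (n ∸ m)) ε)
      ≡⟨ ∑<-cong (suc n) (λ {m} _ → trans (sumQE-⊛ (λ i → A i ⊛ B (m ∸ i)) (upTo (suc m)) (C (n ∸ m)) ε)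
                                          (trans (sumQE-apply (λ i → (A i ⊛ B (m ∸ i)) ⊛ C (n ∸ m)) (upTo (suc m)) ε) (∑-upTo (λ i → F i m) (suc m)))) ⟩
    ∑< (suc n) (λ m → ∑< (suc m) (λ i → F i m))
      ≡⟨ ∑<-triangle n F ⟩
    ∑< (suc n) (λ i → ∑< (suc (n ∸ i)) (λ j → F i (i ℕ.+ j)))
      ≡⟨ ∑<-cong (suc n) (λ {i} _ → ∑<-cong (suc (n ∸ i)) (λ {j} _ →
           trans (cong₂ (λ u v → ((A i ⊛ B u) ⊛ C v) ε) (ℕP.m+n∸m≡n i j) (sym (ℕP.∸-+-assoc n i j)))
                 (⊛-assoc (A i) (B j) (C ((n ∸ i) ∸ j)) ε))) ⟩
    ∑< (suc n) (λ i → ∑< (suc (n ∸ i)) (λ j → (A i ⊛ (B j ⊛ C ((n ∸ i) ∸ j))) ε))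
      ≡⟨ ∑<-cong (suc n) (λ {i} _ → trans (⊛-sumQE (λ j → B j ⊛ C ((n ∸ i) ∸ j)) (upTo (suc (n ∸ i))) (A i) ε)
                                          (trans (sumQE-apply (λ j → A i ⊛ (B j ⊛ C ((n ∸ i) ∸ j))) (upTo (suc (n ∸ i))) ε) (∑-upTo (λ j → (A i ⊛ (B j ⊛ C ((n ∸ i) ∸ j))) ε) (suc (n ∸ i))))) ⟨
    ∑< (suc n) (λ i → (A i ⊛ (B ⊛ₛ C) (n ∸ i)) ε)
      ≡⟨ ⊛ₛ-apply A (B ⊛ₛ C) n ε ⟨
    (A ⊛ₛ (B ⊛ₛ C)) n ε ∎
    where
      open ≡-Reasoning
      F : ℕ → ℕ → ℚ
      F i m = ((A i ⊛ B (m ∸ i)) ⊛ C (n ∸ m)) ε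

  ⊛ₛ-distribˡ : ∀ A B B′ → (A ⊛ₛ (B ⊕ₛ B′)) ≋ ((A ⊛ₛ B) ⊕ₛ (A ⊛ₛ B′))
  ⊛ₛ-distribˡ A B B′ n ε = trans (⊛ₛ-apply A (B ⊕ₛ B′) n ε)
    (trans (∑<-cong (suc n) (λ {k} _ → ⊛-distribˡ (A k) (B (n ∸ k)) (B′ (n ∸ k)) ε))
    (trans (∑<-∙ (suc n) (λ k → (A k ⊛ B (n ∸ k)) ε) (λ k → (A k ⊛ B′ (n ∸ k)) ε))
           (sym (cong₂ _+_ (⊛ₛ-apply A B n ε) (⊛ₛ-apply A B′ n ε)))))

  mono-at : ∀ a k → mono a k k ≡ a
  mono-at a k with k ℕ.≟ k
  ... | yes _   = refl
  ... | no k≢k = ⊥-elim (k≢k refl)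

  mono-off : ∀ a k {m} → m ≢ k → mono a k m ≡ zeroQE
  mono-off a k {m} m≢k with m ℕ.≟ k
  ... | yes m≡k = ⊥-elim (m≢k m≡k)
  ... | no _    = refl

  mono-⊛ₛ : ∀ a k B {n} → k ≤ n → (mono a k ⊛ₛ B) n ≈ᴱ a ⊛ B (n ∸ k)
  mono-⊛ₛ a k B {n} k≤n ε = trans (⊛ₛ-apply (mono a k) B n ε)
    (trans (∑<-single (suc n) k (λ i → (mono a k i ⊛ B (n ∸ i)) ε) (s≤s k≤n)
              (λ {i} _ i≢k → trans (cong (λ z → (z ⊛ B (n ∸ i)) ε) (mono-off a k i≢k)) (⊛-zeroˡ (B (n ∸ i)) ε)))
           (cong (λ z → (z ⊛ B (n ∸ k)) ε) (mono-at a k)))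

  mono-⊛ₛ-below : ∀ a k B {n} → n < k → (mono a k ⊛ₛ B) n ≈ᴱ zeroQE
  mono-⊛ₛ-below a k B {n} n<k ε = trans (⊛ₛ-apply (mono a k) B n ε)
    (∑<-zero (suc n) (λ {i} i<1+n → trans (cong (λ z → (z ⊛ B (n ∸ i)) ε) (mono-off a k (ℕP.<⇒≢ (ℕP.≤-<-trans (ℕP.≤-pred i<1+n) n<k))))
                                          (⊛-zeroˡ (B (n ∸ i)) ε)))

  ⊛ₛ-mono : ∀ a k B {n} → k ≤ n → (B ⊛ₛ mono a k) n ≈ᴱ B (n ∸ k) ⊛ a
  ⊛ₛ-mono a k B {n} k≤n ε = trans (⊛ₛ-apply B (mono a k) n ε)
    (trans (∑<-single (suc n) (n ∸ k) (λ i → (B i ⊛ mono a k (n ∸ i)) ε) (s≤s (ℕP.m∸n≤m n k))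
              (λ {i} i<1+n i≢n∸k → trans (cong (λ z → (B i ⊛ z) ε) (mono-off a k (n∸i≢k (ℕP.≤-pred i<1+n) i≢n∸k))) (⊛-zeroʳ (B i) ε)))
           (trans (cong (λ z → (B (n ∸ k) ⊛ mono a k z) ε) (ℕP.m∸[m∸n]≡n k≤n)) (cong (λ z → (B (n ∸ k) ⊛ z) ε) (mono-at a k))))
    where
      n∸i≢k : ∀ {i} → i ≤ n → i ≢ n ∸ k → n ∸ i ≢ k
      n∸i≢k i≤n i≢n∸k n∸i≡k = i≢n∸k (trans (sym (ℕP.m∸[m∸n]≡n i≤n)) (cong (n ∸_) n∸i≡k))

  ⊛ₛ-mono-below : ∀ a k B {n} → n < k → (B ⊛ₛ mono a k) n ≈ᴱ zeroQE
  ⊛ₛ-mono-below a k B {n} n<k ε = trans (⊛ₛ-apply B (mono a k) n ε)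
    (∑<-zero (suc n) (λ {i} _ → trans (cong (λ z → (B i ⊛ z) ε) (mono-off a k (ℕP.<⇒≢ (ℕP.≤-<-trans (ℕP.m∸n≤m n i) n<k))))
                                      (⊛-zeroʳ (B i) ε)))

  ⊛ₛ-identityʳ : ∀ A → (A ⊛ₛ const ⟨ [] ⟩) ≋ A
  ⊛ₛ-identityʳ A n ε = trans (⊛ₛ-mono ⟨ [] ⟩ 0 A z≤n ε) (⊛-identityʳ (A n) ε)

module LowDegreeSplitting (𝔽 : FiniteField) (ℓ : ℕ) where
  open FiniteField 𝔽
  open Setup 𝔽 ℓ
  open Classes 𝔽 ℓ using (length-filter-cls-allMonic)
  open GroupAlgebra 𝔽 ℓ
  open PowerSeries 𝔽 ℓ
  open ℚSum
  private module ℚR = IsCommutativeRing ℚP.+-*-isCommutativeRing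

  lowPart-apply : ∀ n ε → lowPart n ε ≡ ∑< ℓ (λ d → mono (Fz d) d n ε)
  lowPart-apply n ε = trans (fold (upTo ℓ)) (∑-upTo (λ d → mono (Fz d) d n ε) ℓ)
    where
      fold : ∀ ds → foldr _⊕ₛ_ (λ _ → zeroQE) (map (λ d → mono (Fz d) d) ds) n ε ≡ ∑[ d ← ds ] mono (Fz d) d n ε
      fold []       = refl
      fold (d ∷ ds) = cong (mono (Fz d) d n ε +_) (fold ds)

  lowPart-below : ∀ {n} → n < ℓ → ∀ ε → lowPart n ε ≡ Fz n ε
  lowPart-below {n} n<ℓ ε = trans (lowPart-apply n ε)
    (trans (∑<-single ℓ n (λ d → mono (Fz d) d n ε) n<ℓ (λ {d} _ d≢n → cong (λ a → a ε) (mono-off (Fz d) d (d≢n ∘ sym))))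
           (cong (λ a → a ε) (mono-at (Fz n) n)))

  lowPart-above : ∀ {n} → ℓ ≤ n → ∀ ε → lowPart n ε ≡ 0ℚ
  lowPart-above {n} ℓ≤n ε = trans (lowPart-apply n ε)
    (∑<-zero ℓ (λ {d} d<ℓ → cong (λ a → a ε) (mono-off (Fz d) d (λ n≡d → ℕP.<⇒≱ d<ℓ (subst (ℓ ≤_) n≡d ℓ≤n)))))

  tailPart-below : ∀ {n} → n < ℓ → ∀ ε → tailPart n ε ≡ 0ℚ
  tailPart-below {n} n<ℓ ε = begin
    tailPart n ε                                                  ≡⟨ ⊛ₛ-mono E 0 qℓzℓ/[1-qz] {n} z≤n ε ⟩
    (qℓzℓ/[1-qz] n ⊛ E) ε                                          ≡⟨ ⊛-cong (mono-⊛ₛ-below (scaleQE (toℚ (q ^ ℓ)) ⟨ [] ⟩) ℓ (geom q) {n} n<ℓ) (λ _ → refl) ε ⟩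
    (zeroQE ⊛ E) ε                                                 ≡⟨ ⊛-zeroˡ E ε ⟩
    0ℚ                                                             ∎
    where
      open ≡-Reasoning
      qℓzℓ/[1-qz] = mono (scaleQE (toℚ (q ^ ℓ)) ⟨ [] ⟩) ℓ ⊛ₛ geom q

  -- q^ℓ q^(n-ℓ) E has coefficient q^ℓ q^(n-ℓ) q^-ℓ = q^(n-ℓ) at every class.
  tailPart-above : ∀ {n} → ℓ ≤ n → ∀ ε → tailPart n ε ≡ toℚ (q ^ (n ∸ ℓ))
  tailPart-above {n} ℓ≤n ε = begin
    tailPart n ε
      ≡⟨ ⊛ₛ-mono E 0 qℓzℓ/[1-qz] {n} z≤n ε ⟩
    (qℓzℓ/[1-qz] n ⊛ E) ε
      ≡⟨ ⊛-cong (mono-⊛ₛ (scaleQE qℓ one) ℓ (geom q) {n} ℓ≤n) (λ _ → refl) ε ⟩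
    ((scaleQE qℓ one ⊛ scaleQE qⁿ⁻ℓ one) ⊛ E) ε
      ≡⟨ ⊛-cong (λ e → trans (⊛-scaleˡ qℓ one _ e) (cong (qℓ *_) (trans (⊛-scaleʳ qⁿ⁻ℓ one one e) (cong (qⁿ⁻ℓ *_) (⊛-identityʳ one e)))))
                (λ _ → refl) ε ⟩
    (scaleQE qℓ (scaleQE qⁿ⁻ℓ one) ⊛ E) ε
      ≡⟨ trans (⊛-scaleˡ qℓ _ E ε) (cong (qℓ *_) (trans (⊛-scaleˡ qⁿ⁻ℓ one E ε) (cong (qⁿ⁻ℓ *_) (⊛-identityˡ E ε)))) ⟩
    qℓ * (qⁿ⁻ℓ * E ε)
      ≡⟨ trans (sym (ℚR.*-assoc qℓ qⁿ⁻ℓ (E ε))) (trans (cong (_* E ε) (ℚR.*-comm qℓ qⁿ⁻ℓ)) (ℚR.*-assoc qⁿ⁻ℓ qℓ (E ε))) ⟩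
    qⁿ⁻ℓ * (qℓ * E ε)
      ≡⟨ cong (qⁿ⁻ℓ *_) (n/1*1/n≡1 (q ^ ℓ) {{qℓ-nonZero}}) ⟩
    qⁿ⁻ℓ * 1ℚ
      ≡⟨ ℚR.*-identityʳ qⁿ⁻ℓ ⟩
    qⁿ⁻ℓ ∎
    where
      open ≡-Reasoning
      one = ⟨ [] ⟩
      qℓ = toℚ (q ^ ℓ)
      qⁿ⁻ℓ = toℚ (q ^ (n ∸ ℓ))
      qℓzℓ/[1-qz] = mono (scaleQE qℓ one) ℓ ⊛ₛ geom q

  Fz-above : ∀ {n} → ℓ ≤ n → ∀ ε → Fz n ε ≡ toℚ (q ^ (n ∸ ℓ))
  Fz-above {n} ℓ≤n ε = begin
    Fz n ε                                                   ≡⟨ ⟦⟧-apply (allMonic n) ε ⟩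
    toℚ (length (filter (λ f → cls f ≟C ε) (allMonic n)))    ≡⟨ cong (λ d → toℚ (length (filter (λ f → cls f ≟C ε) (allMonic d)))) (ℕP.m+[n∸m]≡n ℓ≤n) ⟨
    toℚ (length (filter (λ f → cls f ≟C ε) (allMonic (ℓ ℕ.+ (n ∸ ℓ))))) ≡⟨ cong toℚ (length-filter-cls-allMonic (n ∸ ℓ) ε) ⟩
    toℚ (q ^ (n ∸ ℓ))                                        ∎
    where open ≡-Reasoning

  Fz≋lowPart⊕tailPart : Fz ≋ (lowPart ⊕ₛ tailPart)
  Fz≋lowPart⊕tailPart n ε with n ℕP.<? ℓ
  ... | yes n<ℓ = sym (trans (cong₂ _+_ (lowPart-below n<ℓ ε) (tailPart-below n<ℓ ε)) (ℚR.+-identityʳ _))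
  ... | no  n≮ℓ = trans (Fz-above ℓ≤n ε)
                        (sym (trans (cong₂ _+_ (lowPart-above ℓ≤n ε) (tailPart-above ℓ≤n ε)) (ℚR.+-identityˡ _)))
    where ℓ≤n = ℕP.≮⇒≥ n≮ℓ

module Multiples (𝔽 : FiniteField) (ℓ : ℕ) (S : List (FiniteField.K 𝔽)) where
  open FiniteField 𝔽
  open Setup 𝔽 ℓ
  open MonicPolynomials 𝔽 ℓ using (length-mulM; mulM-comm; mulM-injectiveʳ)
  open Enumeration 𝔽 ℓ
  open GroupAlgebra 𝔽 ℓ
  open PowerSeries 𝔽 ℓ

  P : Monic
  P = prodM (map lin S)

  s : ℕ
  s = length S

  length-prodM-lin : ∀ T → length (prodM (map lin T)) ≡ length T
  length-prodM-lin []      = refl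
  length-prodM-lin (α ∷ T) = trans (length-mulM (lin α) (prodM (map lin T))) (cong suc (length-prodM-lin T))

  prodQE-lin : ∀ T → prodQE (map (λ α → ⟨ lin α ⟩) T) ≈ᴱ ⟨ prodM (map lin T) ⟩
  prodQE-lin []      ε = refl
  prodQE-lin (α ∷ T) ε = trans (⊛-cong {⟨ lin α ⟩} (λ _ → refl) (prodQE-lin T) ε) (⟨⟩-⊛ (lin α) (prodM (map lin T)) ε)

  length-mulM-P : ∀ g → length (mulM P g) ≡ s ℕ.+ length g
  length-mulM-P g = trans (length-mulM P g) (cong (ℕ._+ length g) (length-prodM-lin S))

  linPart-⊛ₛ : ∀ (G : ℕ → List Monic) {n} → s ≤ n → ∀ ε →
    (linPart S ⊛ₛ (λ m → ⟦ G m ⟧)) n ε ≡ toℚ (length (filter (λ f → cls f ≟C ε) (map (mulM P) (G (n ∸ s)))))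
  linPart-⊛ₛ G {n} s≤n ε = begin
    (linPart S ⊛ₛ (λ m → ⟦ G m ⟧)) n ε                    ≡⟨ mono-⊛ₛ _ s (λ m → ⟦ G m ⟧) {n} s≤n ε ⟩
    (prodQE (map (λ α → ⟨ lin α ⟩) S) ⊛ ⟦ G (n ∸ s) ⟧) ε ≡⟨ ⊛-cong (prodQE-lin S) (λ _ → refl) ε ⟩
    (⟨ P ⟩ ⊛ ⟦ G (n ∸ s) ⟧) ε                             ≡⟨ ⟨⟩-⊛-⟦⟧ P (G (n ∸ s)) ε ⟩
    ⟦ map (mulM P) (G (n ∸ s)) ⟧ ε                         ≡⟨ ⟦⟧-apply (map (mulM P) (G (n ∸ s))) ε ⟩
    toℚ (length (filter (λ f → cls f ≟C ε) (map (mulM P) (G (n ∸ s))))) ∎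
    where open ≡-Reasoning

  mulM-P-injective : ∀ {g h} → mulM P g ≡ mulM P h → g ≡ h
  mulM-P-injective Pg≡Ph = mulM-injectiveʳ P (trans (mulM-comm _ P) (trans Pg≡Ph (mulM-comm P _)))

  module _ {Q R : Monic → Set} (Q? : ∀ f → Dec (Q f)) (R? : ∀ g → Dec (R g))
           (Q⇔ : ∀ {f} → Q f ⇔ Any (λ g → (mulM g P ≡ f) × R g) (allMonic (length f ∸ s))) where

    multiples-sameMembers : ∀ {d f} → s ≤ d →
      f ∈ filter Q? (allMonic d) ⇔ f ∈ map (mulM P) (filter R? (allMonic (d ∸ s)))
    multiples-sameMembers {d} s≤d = mk⇔ to from
      where
        to : ∀ {f} → f ∈ filter Q? (allMonic d) → f ∈ map (mulM P) (filter R? (allMonic (d ∸ s)))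
        to f∈ with ∈-filter⁻ Q? f∈
        ... | f∈d , Qf with find (Equivalence.to Q⇔ Qf)
        ...   | g , g∈ , gP≡f , Rg = subst (_∈ map (mulM P) _) (trans (mulM-comm P g) gP≡f)
                  (∈-map⁺ (mulM P) (∈-filter⁺ R? (subst (λ e → g ∈ allMonic (e ∸ s)) (length-∈allMonic d f∈d) g∈) Rg))
        from : ∀ {f} → f ∈ map (mulM P) (filter R? (allMonic (d ∸ s))) → f ∈ filter Q? (allMonic d)
        from f∈ with ∈-map⁻ (mulM P) f∈
        ... | g , g∈ , refl with ∈-filter⁻ R? g∈
        ...   | g∈d∸s , Rg = ∈-filter⁺ Q? (∈-allMonic-length |Pg|≡d)
                  (Equivalence.from Q⇔ (lose (∈-allMonic-length (sym |Pg|∸s≡|g|)) (mulM-comm g P , Rg)))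
          where
            |Pg|≡d : length (mulM P g) ≡ d
            |Pg|≡d = trans (length-mulM-P g) (trans (cong (s ℕ.+_) (length-∈allMonic (d ∸ s) g∈d∸s)) (ℕP.m+[n∸m]≡n s≤d))
            |Pg|∸s≡|g| : length (mulM P g) ∸ s ≡ length g
            |Pg|∸s≡|g| = trans (cong (_∸ s) (length-mulM-P g)) (ℕP.m+n∸m≡n s (length g))

    multiples-below : ∀ {d} → d < s → filter Q? (allMonic d) ≡ []
    multiples-below {d} d<s = LP.filter-none Q? (All.tabulate noMultiple)
      where
        noMultiple : ∀ {f} → f ∈ allMonic d → ¬ Q f
        noMultiple f∈ Qf with find (Equivalence.to Q⇔ Qf)
        ... | g , _ , refl , _ = ℕP.<⇒≱ d<s (subst (s ≤_) (trans (cong length (mulM-comm P g)) (length-∈allMonic d f∈))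
                                                   (subst (s ≤_) (sym (length-mulM-P g)) (ℕP.m≤m+n s (length g))))

    -- Multiplication by P raises degrees by |S| and multiplies classes by ⟨P⟩, which is what linPart S does.
    multiples-⊛ₛ : (λ d ε → toℚ (length (filter (λ f → (cls f ≟C ε) ×-dec Q? f) (allMonic d))))
                     ≋ (linPart S ⊛ₛ (λ m → ⟦ filter R? (allMonic m) ⟧))
    multiples-⊛ₛ d ε with s ℕP.≤? d
    ... | yes s≤d = trans (cong toℚ (trans (length-filter-× inε? Q? (allMonic d))
                                           (length-filter-sameMembers inε? (Unique.filter⁺ Q? (allMonic-unique d))
                                              (Unique.map⁺ mulM-P-injective (Unique.filter⁺ R? (allMonic-unique (d ∸ s))))
                                              (multiples-sameMembers s≤d))))
                          (sym (linPart-⊛ₛ (λ m → filter R? (allMonic m)) s≤d ε))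
      where inε? = λ f → cls f ≟C ε
    ... | no s≰d = trans (cong toℚ (trans (length-filter-× (λ f → cls f ≟C ε) Q? (allMonic d))
                                          (cong (λ fs → length (filter (λ f → cls f ≟C ε) fs)) (multiples-below d<s))))
                         (sym (mono-⊛ₛ-below _ s (λ m → ⟦ filter R? (allMonic m) ⟧) {d} d<s ε))
      where d<s = ℕP.≰⇒> s≰d

module Avoiding (𝔽 : FiniteField) (ℓ : ℕ) where
  open FiniteField 𝔽
  open Setup 𝔽 ℓ
  open MonicPolynomials 𝔽 ℓ using (length-mulM; mulM-injectiveʳ)
  open Enumeration 𝔽 ℓ
  open Divisibility 𝔽 ℓ
  open GroupAlgebra 𝔽 ℓ
  open PowerSeries 𝔽 ℓ
  private module ℚR = IsCommutativeRing ℚP.+-*-isCommutativeRing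

  Avoid : List K → Monic → Set
  Avoid R g = All (λ β → ¬ Divides (lin β) g) R

  avoid? : ∀ R g → Dec (Avoid R g)
  avoid? R g = All.all? (λ β → ¬? (Divides? (lin β) g)) R

  avoiding : List K → ℕ → List Monic
  avoiding R m = filter (avoid? R) (allMonic m)

  avoidingSeries : List K → PS
  avoidingSeries R m = ⟦ avoiding R m ⟧

  avoidingSeries-[] : avoidingSeries [] ≋ Fz
  avoidingSeries-[] m ε = cong (λ fs → ⟦ fs ⟧ ε) (LP.filter-all (avoid? []) {allMonic m} (All.tabulate (λ _ → [])))

  avoidingSeries-↭ : ∀ {R R′} → R ↭ R′ → avoidingSeries R ≋ avoidingSeries R′
  avoidingSeries-↭ R↭R′ m ε = cong (λ fs → ⟦ fs ⟧ ε)
    (filter-cong-∈ (avoid? _) (avoid? _) (allMonic m) (λ _ → All-resp-↭ R↭R′) (λ _ → All-resp-↭ (↭-sym R↭R′)))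

  -- A multiple of x + β avoids R iff its cofactor does, since x + β is prime and β ∉ R.
  length-filter-avoiding-split : ∀ {β R} → β ∉ R → ∀ m ε →
    length (filter (λ f → cls f ≟C ε) (avoiding R (suc m)))
      ≡ length (filter (λ f → cls f ≟C ε) (avoiding (β ∷ R) (suc m)))
        ℕ.+ length (filter (λ f → cls f ≟C ε) (map (λ h → mulM h (lin β)) (avoiding R m)))
  length-filter-avoiding-split {β} {R} β∉R m ε = begin
    #ε (avoiding R (suc m))
      ≡⟨ length-filter-split inε? D? (avoiding R (suc m)) ⟩
    #ε (filter D? (avoiding R (suc m))) ℕ.+ #ε (filter (¬? ∘ D?) (avoiding R (suc m)))
      ≡⟨ ℕP.+-comm (#ε (filter D? (avoiding R (suc m)))) _ ⟩
    #ε (filter (¬? ∘ D?) (avoiding R (suc m))) ℕ.+ #ε (filter D? (avoiding R (suc m)))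
      ≡⟨ cong₂ ℕ._+_ (length-filter-sameMembers inε? (Unique.filter⁺ (¬? ∘ D?) {avoiding R (suc m)} uniqueA) (Unique.filter⁺ (avoid? (β ∷ R)) (allMonic-unique (suc m)))
                                                 (mk⇔ notDivisible⇒ ⇒notDivisible))
                     (length-filter-sameMembers inε? (Unique.filter⁺ D? {avoiding R (suc m)} uniqueA) (Unique.map⁺ (mulM-injectiveʳ (lin β)) (Unique.filter⁺ (avoid? R) (allMonic-unique m)))
                                                 (mk⇔ divisible⇒ ⇒divisible)) ⟩
    #ε (avoiding (β ∷ R) (suc m)) ℕ.+ #ε (map (λ h → mulM h (lin β)) (avoiding R m)) ∎
    where
      open ≡-Reasoning
      inε? = λ f → cls f ≟C ε
      #ε : List Monic → ℕ
      #ε fs = length (filter inε? fs)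
      D? = Divides? (lin β)
      uniqueA : Unique (avoiding R (suc m))
      uniqueA = Unique.filter⁺ (avoid? R) (allMonic-unique (suc m))
      notDivisible⇒ : ∀ {f} → f ∈ filter (¬? ∘ D?) (avoiding R (suc m)) → f ∈ avoiding (β ∷ R) (suc m)
      notDivisible⇒ f∈ with ∈-filter⁻ (¬? ∘ D?) {xs = avoiding R (suc m)} f∈
      ... | f∈A , β∤f with ∈-filter⁻ (avoid? R) {xs = allMonic (suc m)} f∈A
      ...   | f∈L , av = ∈-filter⁺ (avoid? (β ∷ R)) f∈L (β∤f ∷ av)
      ⇒notDivisible : ∀ {f} → f ∈ avoiding (β ∷ R) (suc m) → f ∈ filter (¬? ∘ D?) (avoiding R (suc m))
      ⇒notDivisible f∈ with ∈-filter⁻ (avoid? (β ∷ R)) {xs = allMonic (suc m)} f∈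
      ... | f∈L , (β∤f ∷ av) = ∈-filter⁺ (¬? ∘ D?) {xs = avoiding R (suc m)} (∈-filter⁺ (avoid? R) f∈L av) β∤f
      divisible⇒ : ∀ {f} → f ∈ filter D? (avoiding R (suc m)) → f ∈ map (λ h → mulM h (lin β)) (avoiding R m)
      divisible⇒ f∈ with ∈-filter⁻ D? {xs = avoiding R (suc m)} f∈
      ... | f∈A , β∣f with ∈-filter⁻ (avoid? R) {xs = allMonic (suc m)} f∈A | Divides⇒quotient β∣f
      ...   | f∈L , av | h , h∈ , refl = ∈-map⁺ (λ h → mulM h (lin β))
                (∈-filter⁺ (avoid? R) (subst (λ e → h ∈ allMonic (e ∸ 1)) (length-∈allMonic (suc m) f∈L) h∈)
                  (All.tabulate (λ β′∈ β′∣h → All.lookup av β′∈ (Divides-mulMʳ (lin β) β′∣h))))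
      ⇒divisible : ∀ {f} → f ∈ map (λ h → mulM h (lin β)) (avoiding R m) → f ∈ filter D? (avoiding R (suc m))
      ⇒divisible f∈ with ∈-map⁻ (λ h → mulM h (lin β)) f∈
      ... | h , h∈ , refl with ∈-filter⁻ (avoid? R) h∈
      ...   | h∈m , av = ∈-filter⁺ D? {xs = avoiding R (suc m)} (∈-filter⁺ (avoid? R) (∈-allMonic-length |h[x+β]|≡1+m)
                            (All.tabulate (λ β′∈ β′∣h[x+β] → All.lookup av β′∈ (lin∣mulM-lin (λ { refl → β∉R β′∈ }) β′∣h[x+β]))))
                            (quotient⇒Divides h refl)
        where
          |h[x+β]|≡1+m : length (mulM h (lin β)) ≡ suc m
          |h[x+β]|≡1+m = trans (length-mulM h (lin β)) (trans (ℕP.+-comm (length h) 1) (cong suc (length-∈allMonic m h∈m)))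

  ⊛ₛ-oneMinus : ∀ A β n ε → (A ⊛ₛ oneMinus β) n ε ≡ A n ε + (A ⊛ₛ mono (scaleQE (- 1ℚ) ⟨ lin β ⟩) 1) n ε
  ⊛ₛ-oneMinus A β n ε = trans (⊛ₛ-distribˡ A (const ⟨ [] ⟩) (mono (scaleQE (- 1ℚ) ⟨ lin β ⟩) 1) n ε)
                              (cong (_+ (A ⊛ₛ mono (scaleQE (- 1ℚ) ⟨ lin β ⟩) 1) n ε) (⊛ₛ-identityʳ A n ε))

  -- Inclusion–exclusion in one variable: multiplying by 1 - ⟨x+β⟩z removes the multiples of x + β.
  avoidingSeries-⊛ₛ-oneMinus : ∀ {β R} → β ∉ R → (avoidingSeries R ⊛ₛ oneMinus β) ≋ avoidingSeries (β ∷ R)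
  avoidingSeries-⊛ₛ-oneMinus {β} {R} β∉R zero ε = begin
    (avoidingSeries R ⊛ₛ oneMinus β) 0 ε
      ≡⟨ ⊛ₛ-oneMinus (avoidingSeries R) β 0 ε ⟩
    avoidingSeries R 0 ε + (avoidingSeries R ⊛ₛ mono (scaleQE (- 1ℚ) ⟨ lin β ⟩) 1) 0 ε
      ≡⟨ cong (avoidingSeries R 0 ε +_) (⊛ₛ-mono-below (scaleQE (- 1ℚ) ⟨ lin β ⟩) 1 (avoidingSeries R) {0} (s≤s z≤n) ε) ⟩
    avoidingSeries R 0 ε + 0ℚ
      ≡⟨ ℚR.+-identityʳ _ ⟩
    avoidingSeries R 0 ε
      ≡⟨ cong (λ fs → ⟦ fs ⟧ ε) (filter-cong-∈ (avoid? R) (avoid? (β ∷ R)) (allMonic 0)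
           (λ { (here refl) av → lin∤1 β ∷ av }) (λ { (here refl) (_ ∷ av) → av })) ⟩
    avoidingSeries (β ∷ R) 0 ε ∎
    where open ≡-Reasoning
  avoidingSeries-⊛ₛ-oneMinus {β} {R} β∉R (suc m) ε = begin
    (avoidingSeries R ⊛ₛ oneMinus β) (suc m) ε
      ≡⟨ ⊛ₛ-oneMinus (avoidingSeries R) β (suc m) ε ⟩
    avoidingSeries R (suc m) ε + (avoidingSeries R ⊛ₛ mono (scaleQE (- 1ℚ) ⟨ lin β ⟩) 1) (suc m) ε
      ≡⟨ cong (avoidingSeries R (suc m) ε +_) multiples ⟩
    avoidingSeries R (suc m) ε + - 1ℚ * toℚ (#ε (map (λ h → mulM h (lin β)) (avoiding R m)))
      ≡⟨ cong (_+ (- 1ℚ * toℚ (#ε (map (λ h → mulM h (lin β)) (avoiding R m)))))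
              (trans (⟦⟧-apply (avoiding R (suc m)) ε)
                     (trans (cong toℚ (length-filter-avoiding-split β∉R m ε)) (n/1-+ (#ε (avoiding (β ∷ R) (suc m))) (#ε (map (λ h → mulM h (lin β)) (avoiding R m)))))) ⟩
    (toℚ (#ε (avoiding (β ∷ R) (suc m))) + toℚ (#ε (map (λ h → mulM h (lin β)) (avoiding R m))))
      + - 1ℚ * toℚ (#ε (map (λ h → mulM h (lin β)) (avoiding R m)))
      ≡⟨ x+y-y≡x _ _ ⟩
    toℚ (#ε (avoiding (β ∷ R) (suc m)))
      ≡⟨ ⟦⟧-apply (avoiding (β ∷ R) (suc m)) ε ⟨
    avoidingSeries (β ∷ R) (suc m) ε ∎
    where
      open ≡-Reasoning
      #ε : List Monic → ℕ
      #ε fs = length (filter (λ f → cls f ≟C ε) fs)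
      multiples : (avoidingSeries R ⊛ₛ mono (scaleQE (- 1ℚ) ⟨ lin β ⟩) 1) (suc m) ε
                  ≡ - 1ℚ * toℚ (#ε (map (λ h → mulM h (lin β)) (avoiding R m)))
      multiples = begin
        (avoidingSeries R ⊛ₛ mono (scaleQE (- 1ℚ) ⟨ lin β ⟩) 1) (suc m) ε
          ≡⟨ ⊛ₛ-mono (scaleQE (- 1ℚ) ⟨ lin β ⟩) 1 (avoidingSeries R) {suc m} (s≤s z≤n) ε ⟩
        (⟦ avoiding R m ⟧ ⊛ scaleQE (- 1ℚ) ⟨ lin β ⟩) ε
          ≡⟨ ⊛-scaleʳ (- 1ℚ) ⟦ avoiding R m ⟧ ⟨ lin β ⟩ ε ⟩
        - 1ℚ * (⟦ avoiding R m ⟧ ⊛ ⟨ lin β ⟩) ε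
          ≡⟨ cong (- 1ℚ *_) (trans (⟦⟧-⊛ʳ (avoiding R m) (lin β) ε) (⟦⟧-apply (map (λ h → mulM h (lin β)) (avoiding R m)) ε)) ⟩
        - 1ℚ * toℚ (#ε (map (λ h → mulM h (lin β)) (avoiding R m))) ∎
      x+y-y≡x : ∀ x y → (x + y) + - 1ℚ * y ≡ x
      x+y-y≡x x y = trans (cong ((x + y) +_) (RingProperties.-1*x≈-x ℚP.+-*-ring y))
                          (trans (ℚR.+-assoc x y (- y)) (trans (cong (x +_) (ℚR.-‿inverseʳ y)) (ℚR.+-identityʳ x)))

  avoidingSeries-⊛ₛ-prodₛ : ∀ T R → Unique T → (∀ {β} → β ∈ T → β ∉ R) →
    (avoidingSeries R ⊛ₛ prodₛ (map oneMinus T)) ≋ avoidingSeries (T ++ R)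
  avoidingSeries-⊛ₛ-prodₛ []      R _               _        = ⊛ₛ-identityʳ (avoidingSeries R)
  avoidingSeries-⊛ₛ-prodₛ (β ∷ T) R (β∉T ∷ uniqueT) disjoint = begin
    avoidingSeries R ⊛ₛ (oneMinus β ⊛ₛ prodₛ (map oneMinus T))
      ≈⟨ ⊛ₛ-assoc (avoidingSeries R) (oneMinus β) (prodₛ (map oneMinus T)) ⟨
    (avoidingSeries R ⊛ₛ oneMinus β) ⊛ₛ prodₛ (map oneMinus T)
      ≈⟨ ⊛ₛ-congˡ (prodₛ (map oneMinus T)) (avoidingSeries-⊛ₛ-oneMinus (disjoint (here refl))) ⟩
    avoidingSeries (β ∷ R) ⊛ₛ prodₛ (map oneMinus T)
      ≈⟨ avoidingSeries-⊛ₛ-prodₛ T (β ∷ R) uniqueT disjoint′ ⟩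
    avoidingSeries (T ++ β ∷ R)
      ≈⟨ avoidingSeries-↭ (shift β T R) ⟩
    avoidingSeries (β ∷ T ++ R) ∎
    where
      open SetoidReasoning ≋-setoid
      disjoint′ : ∀ {β′} → β′ ∈ T → β′ ∉ β ∷ R
      disjoint′ β′∈T (here refl)  = All.lookup β∉T β′∈T refl
      disjoint′ β′∈T (there β′∈R) = disjoint (there β′∈T) β′∈R

module Decompositions (𝔽 : FiniteField) (ℓ : ℕ) (S : List (FiniteField.K 𝔽)) where
  open FiniteField 𝔽
  open Setup 𝔽 ℓ
  open Enumeration 𝔽 ℓ
  open Divisibility 𝔽 ℓ
  open GroupAlgebra 𝔽 ℓ
  open PowerSeries 𝔽 ℓ
  open Multiples 𝔽 ℓ S
  open Avoiding 𝔽 ℓ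

  Divides-P⇔ : ∀ {f} → Divides P f ⇔ Any (λ g → (mulM g P ≡ f) × ⊤) (allMonic (length f ∸ s))
  Divides-P⇔ {f} = mk⇔ to from
    where
      to : Divides P f → Any (λ g → (mulM g P ≡ f) × ⊤) (allMonic (length f ∸ s))
      to P∣f with Divides⇒quotient P∣f
      ... | g , g∈ , gP≡f = lose (subst (λ e → g ∈ allMonic (length f ∸ e)) (length-prodM-lin S) g∈) (gP≡f , tt)
      from : Any (λ g → (mulM g P ≡ f) × ⊤) (allMonic (length f ∸ s)) → Divides P f
      from gP≡f with find gP≡f
      ... | g , _ , gP≡f , _ = quotient⇒Divides g gP≡f

  Fz⊇S≋linPart⊛ₛFz : Fz⊇S S ≋ (linPart S ⊛ₛ Fz)
  Fz⊇S≋linPart⊛ₛFz = ≋-trans (multiples-⊛ₛ (Divides? P) (λ _ → yes tt) Divides-P⇔)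
                              (⊛ₛ-congʳ (linPart S) (λ m ε → cong (λ fs → ⟦ fs ⟧ ε) (LP.filter-all (λ _ → yes tt) {allMonic m} (All.tabulate _))))

  FzS≋linPart⊛ₛFz⊛ₛprodₛ : FzS S ≋ ((linPart S ⊛ₛ Fz) ⊛ₛ prodₛ (map oneMinus (complement S)))
  FzS≋linPart⊛ₛFz⊛ₛprodₛ = begin
    FzS S                                     ≈⟨ multiples-⊛ₛ (IsN? S) (avoid? C) (mk⇔ id id) ⟩
    linPart S ⊛ₛ avoidingSeries C             ≈⟨ ⊛ₛ-congʳ (linPart S) avoiding-C ⟨
    linPart S ⊛ₛ (avoidingSeries [] ⊛ₛ ΠC)    ≈⟨ ⊛ₛ-congʳ (linPart S) (⊛ₛ-congˡ ΠC avoidingSeries-[]) ⟩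
    linPart S ⊛ₛ (Fz ⊛ₛ ΠC)                   ≈⟨ ⊛ₛ-assoc (linPart S) Fz ΠC ⟨
    (linPart S ⊛ₛ Fz) ⊛ₛ ΠC                   ∎
    where
      open SetoidReasoning ≋-setoid
      C = complement S
      ΠC = prodₛ (map oneMinus C)
      avoiding-C : (avoidingSeries [] ⊛ₛ ΠC) ≋ avoidingSeries C
      avoiding-C = ≋-trans (avoidingSeries-⊛ₛ-prodₛ C [] (Unique.filter⁺ _ elems-unique) (λ _ ()))
                           (λ m ε → cong (λ R → avoidingSeries R m ε) (LP.++-identityʳ C))

-- The identities hold for every ℓ and every list S.
proposition2 : (𝔽 : FiniteField) (ℓ : ℕ) → 1 ≤ ℓ →
    (D S : List (FiniteField.K 𝔽)) → Unique D → Unique S → S ⊆ D →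
    let open Setup 𝔽 ℓ in
    (Fz ≋ (lowPart ⊕ₛ tailPart))
    × (Fz⊇S S ≋ (linPart S ⊛ₛ Fz))
    × (FzS S ≋ ((linPart S ⊛ₛ Fz) ⊛ₛ prodₛ (map oneMinus (complement S))))
proposition2 𝔽 ℓ _ _ S _ _ _ =
  LowDegreeSplitting.Fz≋lowPart⊕tailPart 𝔽 ℓ ,
  Decompositions.Fz⊇S≋linPart⊛ₛFz 𝔽 ℓ S ,
  Decompositions.FzS≋linPart⊛ₛFz⊛ₛprodₛ 𝔽 ℓ S
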